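{- Let $n\ge1$ and $k\ge4$ be integers. Then there exists an $(n+k)$-dimensional integral polytope $\mathcal{P}$ such that the coefficients of $t^{n+k-2},t^{n+k-3},\dots,t^{n+3}$ in $i(\mathcal{P},t)$ are positive and the coefficients of $t^{n+2},t^{n+1},\dots,t$ in $i(\mathcal{P},t)$ are negative.
   Context: An integral polytope is a convex polytope all of whose vertices have integer coordinates. For an integral polytope $\mathcal{P}\subseteq\mathbb{R}^N$ of dimension $d$, $i(\mathcal{P},t)=|t\mathcal{P}\cap\mathbb{Z}^N|$ ($t$ a positive integer) is a polynomial in $t$ of degree $d$, the Ehrhart polynomial. -}

module Defs where

open import Data.Nat as ℕ using (ℕ; zero; suc)
open import Data.Integer as ℤ using (ℤ; +_)
open import Data.Rational using (ℚ; 0ℚ; 1ℚ; _+_; _*_; _≤_; _/_)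
open import Data.Fin using (Fin; zero; suc)
open import Data.Vec using (Vec; lookup)
open import Data.List using (List; length)
open import Data.List.Relation.Unary.Unique.Propositional using (Unique)
open import Data.List.Membership.Propositional using (_∈_)
open import Data.Product using (Σ; _×_; ∃)
open import Function.Bundles using (_⇔_)
open import Relation.Binary.PropositionalEquality using (_≡_)
open import Relation.Nullary using (¬_)

ℤ→ℚ : ℤ → ℚ
ℤ→ℚ z = z / 1

ℕ→ℚ : ℕ → ℚ
ℕ→ℚ n = ℤ→ℚ (+ n)

sumℚ : (n : ℕ) → (Fin n → ℚ) → ℚ
sumℚ zero    f = 0ℚ
sumℚ (suc n) f = f zero + sumℚ n (λ i → f (suc i))

_^ℚ_ : ℚ → ℕ → ℚ
q ^ℚ zero  = 1ℚ
q ^ℚ suc n = q * (q ^ℚ n)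

Point : ℕ → Set
Point N = Vec ℤ N

-- An integral polytope P ⊆ ℝ^N is given as conv(V(0),…,V(m-1)) with V(i) ∈ ℤ^N.
-- z ∈ t·P  (for an integer point z) : z is a convex combination of the t·V(i).
-- (For rational points, rational weights suffice, so ℚ is faithful here.)
InDilate : {N m : ℕ} → (Fin m → Point N) → ℕ → Point N → Set
InDilate {N} {m} V t z =
  Σ (Fin m → ℚ) λ w →
    (∀ i → 0ℚ ≤ w i) ×
    (sumℚ m w ≡ 1ℚ) ×
    (∀ (j : Fin N) → sumℚ m (λ i → w i * (ℕ→ℚ t * ℤ→ℚ (lookup (V i) j))) ≡ ℤ→ℚ (lookup z j))

AffIndep : {N r : ℕ} → (Fin (suc r) → Point N) → Set
AffIndep {N} {r} p =
  (c : Fin (suc r) → ℚ) →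
  sumℚ (suc r) c ≡ 0ℚ →
  (∀ (j : Fin N) → sumℚ (suc r) (λ i → c i * ℤ→ℚ (lookup (p i) j)) ≡ 0ℚ) →
  ∀ i → c i ≡ 0ℚ

HasDim : {N m : ℕ} → (Fin m → Point N) → ℕ → Set
HasDim {N} {m} V d =
  (Σ (Fin (suc d) → Fin m) λ f → AffIndep (λ i → V (f i))) ×
  (∀ (g : Fin (suc (suc d)) → Fin m) → ¬ AffIndep (λ i → V (g i)))

LatticeCount : {N m : ℕ} → (Fin m → Point N) → ℕ → ℕ → Set
LatticeCount {N} V t c =
  Σ (List (Point N)) λ L → Unique L × (∀ z → (z ∈ L) ⇔ InDilate V t z) × (length L ≡ c)

evalPoly : ℕ → (ℕ → ℚ) → ℕ → ℚ
evalPoly zero    a t = a 0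
evalPoly (suc d) a t = a (suc d) * (ℕ→ℚ t ^ℚ suc d) + evalPoly d a t

IsEhrhartPoly : {N m : ℕ} → (Fin m → Point N) → ℕ → (ℕ → ℚ) → Set
IsEhrhartPoly V d a =
  (∀ j → d ℕ.< j → a j ≡ 0ℚ) ×
  (∀ t → 1 ℕ.≤ t → Σ ℕ λ c → LatticeCount V t c × ℕ→ℚ c ≡ evalPoly d a t)

-- The polytope is P = sT × [0, L]^N with s = k − 3, L = n + 1, N = n + s, and T = conv(0, e₁, e₂, (1, 1, m)),
-- a Reeve tetrahedron with m = 6μ; its dimension is its ambient dimension 3 + N = n + k.
-- Lattice-point counts multiply over products, i(sT, t) = μ(st)³ + (st)² + (2 − μ)st + 1 and
-- i([0, L]^N, t) = (1 + Lt)^N, so with b_i = C(N, i)·L^i the coefficient of t^j in i(P, t) is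
--   A_j + μ·(s³·b_{j−3} − s·b_{j−1}),   where 0 ≤ A_j = b_j + 2s·b_{j−1} + s²·b_{j−2}.
-- Taking μ > A_j for all j, the sign is decided by s³·b_{j−3} − s·b_{j−1}, which for j ≥ 3 has the sign of
-- s²·C(N, j−3) − L²·C(N, j−1). As C(N, b+2)·(b+2)(b+1) = C(N, b)·(N−b)(N−b−1), it is negative for
-- j ≤ n + 2 and non-negative for j ≥ n + 3, while for j = 1, 2 only the negative term is present.

module Submission where

open import Algebra.Bundles using (Monoid; CommutativeRing)
import Algebra.Properties.Monoid.Sum as MonoidSum
import Algebra.Properties.Semiring.Sum as SemiringSum
open import Data.Empty using (⊥; ⊥-elim)
open import Data.Fin using (Fin; zero; suc; _↑ˡ_; _↑ʳ_; combine; remQuot; splitAt; punchIn)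
import Data.Fin.Properties as FinP
open import Data.Integer as ℤ using (ℤ; +_; -[1+_]; _⊖_)
import Data.Integer.Properties as ℤP
import Data.Integer.Tactic.RingSolver as ℤSolver
open import Data.List as List using (List; length; cartesianProduct; upTo)
import Data.List.Properties as ListP
open import Data.List.Membership.Propositional using (_∈_)
import Data.List.Membership.Propositional.Properties as ∈P
import Data.List.Relation.Unary.All as All
import Data.List.Relation.Unary.AllPairs as AllPairs
open import Data.List.Relation.Unary.Any using (here)
open import Data.List.Relation.Unary.Unique.Propositional using (Unique)
import Data.List.Relation.Unary.Unique.Propositional.Properties as UniqueP
import Data.Nat as ℕ
open ℕ using (ℕ; zero; suc; _+_; _*_; _∸_; _^_; _≤_; _<_; z≤n; s≤s)
import Data.Nat.Coprimality as Coprimality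
open import Data.Nat.Combinatorics using (_C_; nCk+nC[k+1]≡[n+1]C[k+1]; k>n⇒nCk≡0; nC1≡n)
import Data.Nat.Properties as ℕP
import Data.Nat.Tactic.RingSolver as ℕSolver
open import Data.Product using (Σ; ∃; _×_; _,_; proj₁; proj₂; uncurry)
open import Data.Rational as ℚ using (ℚ; mkℚ; 0ℚ; 1ℚ) renaming (_<_ to _<ℚ_)
import Data.Rational.Properties as ℚP
open import Data.Sum as Sum using (_⊎_; inj₁; inj₂; [_,_]; [_,_]′)
open import Data.Vec as Vec using ([]; _∷_; lookup; _++_)
import Data.Vec.Properties as VecP
open import Data.Vec.Functional using (Vector; insertAt)
import Data.Vec.Functional.Properties as VecFP
open import Function using (_∘_; id)
open import Function.Bundles using (_⇔_; mk⇔; Equivalence)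
open import Function.Definitions using (Injective)
open import Level using (0ℓ)
open import Relation.Nullary using (¬_; yes; no)
open import Relation.Nullary.Decidable using (dec⇒maybe)
open import Relation.Binary.PropositionalEquality
  using (_≡_; _≢_; refl; sym; trans; cong; cong₂; subst; subst₂; module ≡-Reasoning)
import Tactic.RingSolver as RingSolver
open import Tactic.RingSolver.Core.AlmostCommutativeRing using (AlmostCommutativeRing; fromCommutativeRing)

open import Defs

-- Integers inside the rationals

-- ℤ→ℚ z = z / 1 is already in normal form, so the embedding lemmas become computations on mkℚ.
ℤ→ℚ≡mkℚ : ∀ z → ℤ→ℚ z ≡ mkℚ z 0 (Coprimality.sym (Coprimality.1-coprimeTo ℤ.∣ z ∣))
ℤ→ℚ≡mkℚ z = ℚP.↥p/↧p≡p (mkℚ z 0 _)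

ℤ→ℚ-homo-+ : ∀ a b → ℤ→ℚ (a ℤ.+ b) ≡ ℤ→ℚ a ℚ.+ ℤ→ℚ b
ℤ→ℚ-homo-+ a b rewrite ℤ→ℚ≡mkℚ a | ℤ→ℚ≡mkℚ b =
  cong (ℚ._/ 1) (sym (cong₂ ℤ._+_ (ℤP.*-identityʳ a) (ℤP.*-identityʳ b)))

ℤ→ℚ-homo-* : ∀ a b → ℤ→ℚ (a ℤ.* b) ≡ ℤ→ℚ a ℚ.* ℤ→ℚ b
ℤ→ℚ-homo-* a b rewrite ℤ→ℚ≡mkℚ a | ℤ→ℚ≡mkℚ b = refl

ℤ→ℚ-mono-≤ : ∀ {a b} → a ℤ.≤ b → ℤ→ℚ a ℚ.≤ ℤ→ℚ b
ℤ→ℚ-mono-≤ {a} {b} a≤b rewrite ℤ→ℚ≡mkℚ a | ℤ→ℚ≡mkℚ b =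
  ℚ.*≤* (subst₂ ℤ._≤_ (sym (ℤP.*-identityʳ a)) (sym (ℤP.*-identityʳ b)) a≤b)

ℤ→ℚ-cancel-≤ : ∀ {a b} → ℤ→ℚ a ℚ.≤ ℤ→ℚ b → a ℤ.≤ b
ℤ→ℚ-cancel-≤ {a} {b} le rewrite ℤ→ℚ≡mkℚ a | ℤ→ℚ≡mkℚ b with le
... | ℚ.*≤* a*1≤b*1 = subst₂ ℤ._≤_ (ℤP.*-identityʳ a) (ℤP.*-identityʳ b) a*1≤b*1

ℤ→ℚ-mono-< : ∀ {a b} → a ℤ.< b → ℤ→ℚ a ℚ.< ℤ→ℚ b
ℤ→ℚ-mono-< {a} {b} a<b rewrite ℤ→ℚ≡mkℚ a | ℤ→ℚ≡mkℚ b =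
  ℚ.*<* (subst₂ ℤ._<_ (sym (ℤP.*-identityʳ a)) (sym (ℤP.*-identityʳ b)) a<b)

ℤ→ℚ-injective : ∀ {a b} → ℤ→ℚ a ≡ ℤ→ℚ b → a ≡ b
ℤ→ℚ-injective a≡b =
  ℤP.≤-antisym (ℤ→ℚ-cancel-≤ (ℚP.≤-reflexive a≡b)) (ℤ→ℚ-cancel-≤ (ℚP.≤-reflexive (sym a≡b)))

*-nonNeg : ∀ {p q} → 0ℚ ℚ.≤ p → 0ℚ ℚ.≤ q → 0ℚ ℚ.≤ p ℚ.* q
*-nonNeg {p} {q} 0≤p 0≤q =
  ℚP.nonNegative⁻¹ _ {{ℚP.nonNeg*nonNeg⇒nonNeg p {{ℚ.nonNegative 0≤p}} q {{ℚ.nonNegative 0≤q}}}}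

ℚ-ring : AlmostCommutativeRing 0ℓ 0ℓ
ℚ-ring = fromCommutativeRing ℚP.+-*-commutativeRing (λ x → dec⇒maybe (0ℚ ℚP.≟ x))

-- Not ℕ→ℚ (suc d): its numerator is stuck on gcd (suc d) 1, so ℚ.1/ would find no NonZero instance.
private
  mkℚ-suc : ℕ → ℚ
  mkℚ-suc d = mkℚ (+ suc d) 0 (Coprimality.sym (Coprimality.1-coprimeTo (suc d)))

1/suc : ℕ → ℚ
1/suc d = ℚ.1/ mkℚ-suc d

1/suc-inverse : ∀ d → 1/suc d ℚ.* ℕ→ℚ (suc d) ≡ 1ℚ
1/suc-inverse d = trans (cong (1/suc d ℚ.*_) (ℤ→ℚ≡mkℚ (+ suc d))) (ℚP.*-inverseˡ (mkℚ-suc d))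

1/suc-nonNeg : ∀ d → 0ℚ ℚ.≤ 1/suc d
1/suc-nonNeg d = ℚP.nonNegative⁻¹ _ {{ℚP.pos⇒nonNeg (1/suc d) {{ℚP.1/pos⇒pos (mkℚ-suc d)}}}}

ℤ→ℚ-gap⇒≤ : ∀ {a b : ℤ} {c w : ℚ} → ℤ→ℚ b ≡ ℤ→ℚ a ℚ.+ c ℚ.* w →
            0ℚ ℚ.≤ c → 0ℚ ℚ.≤ w → a ℤ.≤ b
ℤ→ℚ-gap⇒≤ {a} {b} {c} {w} b≡a+cw 0≤c 0≤w = ℤ→ℚ-cancel-≤ (begin
  ℤ→ℚ a              ≡⟨ ℚP.+-identityʳ (ℤ→ℚ a) ⟨
  ℤ→ℚ a ℚ.+ 0ℚ       ≤⟨ ℚP.+-monoʳ-≤ (ℤ→ℚ a) (*-nonNeg 0≤c 0≤w) ⟩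
  ℤ→ℚ a ℚ.+ c ℚ.* w  ≡⟨ b≡a+cw ⟨
  ℤ→ℚ b              ∎)
  where open ℚP.≤-Reasoning

p*[1+d]≡0⇒p≡0 : ∀ p d → p ℚ.* ℕ→ℚ (suc d) ≡ 0ℚ → p ≡ 0ℚ
p*[1+d]≡0⇒p≡0 p d p*[1+d]≡0 = begin
  p                                 ≡⟨ ℚP.*-identityʳ p ⟨
  p ℚ.* 1ℚ                          ≡⟨ cong (p ℚ.*_) (trans (ℚP.*-comm (ℕ→ℚ (suc d)) (1/suc d)) (1/suc-inverse d)) ⟨
  p ℚ.* (ℕ→ℚ (suc d) ℚ.* 1/suc d)   ≡⟨ ℚP.*-assoc p _ _ ⟨
  p ℚ.* ℕ→ℚ (suc d) ℚ.* 1/suc d     ≡⟨ cong (ℚ._* 1/suc d) p*[1+d]≡0 ⟩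
  0ℚ ℚ.* 1/suc d                    ≡⟨ ℚP.*-zeroˡ (1/suc d) ⟩
  0ℚ                                ∎
  where open ≡-Reasoning

ℕ→ℚ-nonNeg : ∀ n → 0ℚ ℚ.≤ ℕ→ℚ n
ℕ→ℚ-nonNeg n = ℤ→ℚ-mono-≤ {+ 0} {+ n} (ℤ.+≤+ z≤n)

*-cast : ∀ a b {x y} → + a ≡ x → + b ≡ y → + (a * b) ≡ x ℤ.* y
*-cast a b a≡x b≡y = trans (ℤP.pos-* a b) (cong₂ ℤ._*_ a≡x b≡y)

^-cast : ∀ a n → + (a ^ n) ≡ (+ a) ℤ.^ n
^-cast a zero    = refl
^-cast a (suc n) = *-cast a (a ^ n) refl (^-cast a n)

-- Finite sums

module _ {c ℓ} (M : Monoid c ℓ) where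
  open Monoid M using (Carrier; _≈_; _∙_; assoc; identityˡ; ∙-congˡ)
  open MonoidSum M using (sum)

  sum-↑ : ∀ m {n} (f : Vector Carrier (m + n)) →
          sum f ≈ sum (f ∘ (_↑ˡ n)) ∙ sum (f ∘ (m ↑ʳ_))
  sum-↑ zero    f = Monoid.sym M (identityˡ (sum f))
  sum-↑ (suc m) {n} f = Monoid.trans M (∙-congˡ (sum-↑ m (f ∘ suc)))
    (Monoid.sym M (assoc (f zero) (sum (f ∘ suc ∘ (_↑ˡ n))) (sum (f ∘ (suc m ↑ʳ_)))))

  sum-combine : ∀ m {n} (f : Vector Carrier (m * n)) →
                sum f ≈ sum {m} (λ i → sum {n} (λ j → f (combine i j)))
  sum-combine zero    f = Monoid.refl M
  sum-combine (suc m) {n} f = Monoid.trans M (sum-↑ n f) (∙-congˡ (sum-combine m (f ∘ (n ↑ʳ_))))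

module ℤΣ = SemiringSum ℤP.+-*-semiring
module ℚΣ = SemiringSum (CommutativeRing.semiring ℚP.+-*-commutativeRing)

sumℚ≡sum : ∀ n (f : Fin n → ℚ) → sumℚ n f ≡ ℚΣ.sum f
sumℚ≡sum zero    f = refl
sumℚ≡sum (suc n) f = cong (f zero ℚ.+_) (sumℚ≡sum n (f ∘ suc))

ℤ→ℚ-homo-sum : ∀ n (f : Fin n → ℤ) → ℤ→ℚ (ℤΣ.sum f) ≡ sumℚ n (ℤ→ℚ ∘ f)
ℤ→ℚ-homo-sum zero    f = refl
ℤ→ℚ-homo-sum (suc n) f =
  trans (ℤ→ℚ-homo-+ (f zero) _) (cong (ℤ→ℚ (f zero) ℚ.+_) (ℤ→ℚ-homo-sum n (f ∘ suc)))

sumℚ-nonNeg : ∀ n (f : Fin n → ℚ) → (∀ i → 0ℚ ℚ.≤ f i) → 0ℚ ℚ.≤ sumℚ n f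
sumℚ-nonNeg zero    f f≥0 = ℚP.≤-refl
sumℚ-nonNeg (suc n) f f≥0 = ℚP.+-mono-≤ (f≥0 zero) (sumℚ-nonNeg n (f ∘ suc) (f≥0 ∘ suc))

sumℚ-via : ∀ {m n} (f : Fin m → ℚ) (g : Fin n → ℚ) → ℚΣ.sum f ≡ ℚΣ.sum g → sumℚ m f ≡ sumℚ n g
sumℚ-via {m} {n} f g eq = trans (sumℚ≡sum m f) (trans eq (sym (sumℚ≡sum n g)))

sumℚ-cong : ∀ n {f g : Fin n → ℚ} → (∀ i → f i ≡ g i) → sumℚ n f ≡ sumℚ n g
sumℚ-cong n {f} {g} f≗g = sumℚ-via f g (ℚΣ.sum-cong-≗ f≗g)

sumℚ-zero : ∀ n → sumℚ n (λ _ → 0ℚ) ≡ 0ℚ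
sumℚ-zero n = trans (sumℚ≡sum n _) (ℚΣ.sum-replicate-zero n)

sumℚ-*ˡ : ∀ n c (f : Fin n → ℚ) → c ℚ.* sumℚ n f ≡ sumℚ n (λ i → c ℚ.* f i)
sumℚ-*ˡ n c f = trans (cong (c ℚ.*_) (sumℚ≡sum n f)) (trans (ℚΣ.*-distribˡ-sum c f) (sym (sumℚ≡sum n _)))

sumℚ-*ʳ : ∀ n c (f : Fin n → ℚ) → sumℚ n f ℚ.* c ≡ sumℚ n (λ i → f i ℚ.* c)
sumℚ-*ʳ n c f = trans (cong (ℚ._* c) (sumℚ≡sum n f)) (trans (ℚΣ.*-distribʳ-sum c f) (sym (sumℚ≡sum n _)))

sumℚ-↑ : ∀ m n (f : Fin (m + n) → ℚ) →
         sumℚ (m + n) f ≡ sumℚ m (f ∘ (_↑ˡ n)) ℚ.+ sumℚ n (f ∘ (m ↑ʳ_))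
sumℚ-↑ m n f = trans (sumℚ≡sum (m + n) f) (trans (sum-↑ ℚP.+-0-monoid m f)
  (sym (cong₂ ℚ._+_ (sumℚ≡sum m _) (sumℚ≡sum n _))))

sumℚ-combine : ∀ m n (f : Fin (m * n) → ℚ) →
               sumℚ (m * n) f ≡ sumℚ m (λ i → sumℚ n (λ j → f (combine i j)))
sumℚ-combine m n f = sumℚ-via f (λ (i : Fin m) → sumℚ n (λ j → f (combine i j)))
  (trans (sum-combine ℚP.+-0-monoid m {n} f)
  (ℚΣ.sum-cong-≗ (λ (i : Fin m) → sym (sumℚ≡sum n (λ j → f (combine i j))))))

sumℚ-combine-comm : ∀ m n (f : Fin (m * n) → ℚ) →
                    sumℚ (m * n) f ≡ sumℚ n (λ j → sumℚ m (λ i → f (combine i j)))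
sumℚ-combine-comm m n f = sumℚ-via f (λ (j : Fin n) → sumℚ m (λ i → f (combine i j)))
  (trans (sum-combine ℚP.+-0-monoid m {n} f)
  (trans (ℚΣ.∑-comm (λ (i : Fin m) (j : Fin n) → f (combine i j)))
  (ℚΣ.sum-cong-≗ (λ j → sym (sumℚ≡sum m (λ i → f (combine i j)))))))

↑-induction : ∀ {m n} (P : Fin (m + n) → Set) →
              (∀ i → P (i ↑ˡ n)) → (∀ j → P (m ↑ʳ j)) → ∀ k → P k
↑-induction {m} P left right k with splitAt m k in eq
... | inj₁ i = subst P (FinP.splitAt⁻¹-↑ˡ eq) (left i)
... | inj₂ j = subst P (FinP.splitAt⁻¹-↑ʳ eq) (right j)

module _ {m₁ m₂ : ℕ} (w c : Fin (m₁ * m₂) → ℚ) where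

  sumℚ-rows : (g : Fin m₁ → ℚ) → (∀ i j → c (combine i j) ≡ g i) →
              sumℚ (m₁ * m₂) (λ k → w k ℚ.* c k) ≡ sumℚ m₁ (λ i → sumℚ m₂ (λ j → w (combine i j)) ℚ.* g i)
  sumℚ-rows g c≡g = trans (sumℚ-combine m₁ m₂ _) (sumℚ-cong m₁ λ i →
    trans (sumℚ-cong m₂ (λ j → cong (w (combine i j) ℚ.*_) (c≡g i j))) (sym (sumℚ-*ʳ m₂ (g i) _)))

  sumℚ-cols : (g : Fin m₂ → ℚ) → (∀ i j → c (combine i j) ≡ g j) →
              sumℚ (m₁ * m₂) (λ k → w k ℚ.* c k) ≡ sumℚ m₂ (λ j → sumℚ m₁ (λ i → w (combine i j)) ℚ.* g j)
  sumℚ-cols g c≡g = trans (sumℚ-combine-comm m₁ m₂ _) (sumℚ-cong m₂ λ j →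
    trans (sumℚ-cong m₁ (λ i → cong (w (combine i j) ℚ.*_) (c≡g i j))) (sym (sumℚ-*ʳ m₁ (g j) _)))

-- Finite sets of a given size

HasSize : {A : Set} → (A → Set) → ℕ → Set
HasSize {A} P c = Σ (List A) λ xs → Unique xs × (∀ z → (z ∈ xs) ⇔ P z) × (length xs ≡ c)

module _ {A : Set} where

  HasSize-resp-⇔ : ∀ {P Q : A → Set} {c} → (∀ z → P z ⇔ Q z) → HasSize P c → HasSize Q c
  HasSize-resp-⇔ P⇔Q (xs , uniq , mem , len) =
    xs , uniq , (λ z → mk⇔ (Equivalence.to (P⇔Q z) ∘ Equivalence.to (mem z))
                           (Equivalence.from (mem z) ∘ Equivalence.from (P⇔Q z))) , len

  HasSize-∅ : ∀ {P : A → Set} → (∀ z → ¬ P z) → HasSize P 0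
  HasSize-∅ ¬P = List.[] , AllPairs.[] , (λ z → mk⇔ (λ ()) (λ p → ⊥-elim (¬P z p))) , refl

  HasSize-⊎ : ∀ {P Q : A → Set} {a b} → (∀ z → P z → Q z → ⊥) →
              HasSize P a → HasSize Q b → HasSize (λ z → P z ⊎ Q z) (a + b)
  HasSize-⊎ disjoint (xs , uxs , mxs , lxs) (ys , uys , mys , lys) =
    xs List.++ ys ,
    UniqueP.++⁺ uxs uys (λ (x∈xs , x∈ys) → disjoint _ (Equivalence.to (mxs _) x∈xs) (Equivalence.to (mys _) x∈ys)) ,
    (λ z → mk⇔ (Sum.map (Equivalence.to (mxs z)) (Equivalence.to (mys z)) ∘ ∈P.∈-++⁻ xs)
               [ ∈P.∈-++⁺ˡ ∘ Equivalence.from (mxs z) , ∈P.∈-++⁺ʳ xs ∘ Equivalence.from (mys z) ]) ,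
    trans (ListP.length-++ xs) (cong₂ _+_ lxs lys)

module _ {A B : Set} where

  HasSize-image : ∀ {P : A → Set} {c} (f : A → B) → Injective _≡_ _≡_ f →
                  HasSize P c → HasSize (λ z → ∃ λ a → P a × z ≡ f a) c
  HasSize-image f f-inj (xs , uxs , mxs , lxs) =
    List.map f xs , UniqueP.map⁺ f-inj uxs ,
    (λ z → mk⇔ (λ z∈ → let a , a∈xs , z≡fa = ∈P.∈-map⁻ f z∈ in a , Equivalence.to (mxs a) a∈xs , z≡fa)
               (λ { (a , pa , refl) → ∈P.∈-map⁺ f (Equivalence.from (mxs a) pa) })) ,
    trans (ListP.length-map f xs) lxs

  length-cartesianProduct : ∀ (xs : List A) (ys : List B) →
                            length (cartesianProduct xs ys) ≡ length xs * length ys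
  length-cartesianProduct List.[]  ys = refl
  length-cartesianProduct (x List.∷ xs) ys = trans (ListP.length-++ (List.map (x ,_) ys))
    (cong₂ _+_ (ListP.length-map (x ,_) ys) (length-cartesianProduct xs ys))

  HasSize-× : ∀ {P : A → Set} {Q : B → Set} {a b} →
              HasSize P a → HasSize Q b → HasSize (λ (z : A × B) → P (proj₁ z) × Q (proj₂ z)) (a * b)
  HasSize-× (xs , uxs , mxs , lxs) (ys , uys , mys , lys) =
    cartesianProduct xs ys , UniqueP.cartesianProduct⁺ uxs uys ,
    (λ (x , y) → mk⇔ (λ xy∈ → let x∈ , y∈ = ∈P.∈-cartesianProduct⁻ xs ys xy∈ in
                                Equivalence.to (mxs x) x∈ , Equivalence.to (mys y) y∈)
                     (λ (px , qy) → ∈P.∈-cartesianProduct⁺ (Equivalence.from (mxs x) px) (Equivalence.from (mys y) qy))) ,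
    trans (length-cartesianProduct xs ys) (cong₂ _*_ lxs lys)

HasSize-< : ∀ k → HasSize (_< k) k
HasSize-< k = upTo k , UniqueP.upTo⁺ k , (λ i → mk⇔ ∈P.∈-upTo⁻ ∈P.∈-upTo⁺) , ListP.length-upTo k

-- Dilates and products of lattice polytopes

dilatedCoord : ∀ {N m} → (Fin m → Point N) → ℕ → Fin m → Fin N → ℚ
dilatedCoord V t i j = ℕ→ℚ t ℚ.* ℤ→ℚ (lookup (V i) j)

module _ {N m : ℕ} (V : Fin m → Point N) (t : ℕ) where

  InDilate-fromIntegerWeights :
    ∀ D .{{_ : ℕ.NonZero D}} (z : Point N) (n : Fin m → ℤ) → (∀ i → + 0 ℤ.≤ n i) → ℤΣ.sum n ≡ + D →
    (∀ j → ℤΣ.sum (λ i → n i ℤ.* (+ t ℤ.* lookup (V i) j)) ≡ + D ℤ.* lookup z j) →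
    InDilate V t z
  InDilate-fromIntegerWeights (suc d) z n n≥0 n-sum n-coord = w , w≥0 , w-sum , w-coord
    where
    w : Fin m → ℚ
    w i = ℤ→ℚ (n i) ℚ.* 1/suc d
    w≥0 : ∀ i → 0ℚ ℚ.≤ w i
    w≥0 i = *-nonNeg (ℤ→ℚ-mono-≤ (n≥0 i)) (1/suc-nonNeg d)
    w-sum : sumℚ m w ≡ 1ℚ
    w-sum = begin
      sumℚ m w                      ≡⟨ sumℚ-*ʳ m (1/suc d) (ℤ→ℚ ∘ n) ⟨
      sumℚ m (ℤ→ℚ ∘ n) ℚ.* 1/suc d  ≡⟨ cong (ℚ._* 1/suc d) (trans (sym (ℤ→ℚ-homo-sum m n)) (cong ℤ→ℚ n-sum)) ⟩
      ℕ→ℚ (suc d) ℚ.* 1/suc d       ≡⟨ ℚP.*-comm (ℕ→ℚ (suc d)) (1/suc d) ⟩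
      1/suc d ℚ.* ℕ→ℚ (suc d)       ≡⟨ 1/suc-inverse d ⟩
      1ℚ                            ∎
      where open ≡-Reasoning
    w-coord : ∀ j → sumℚ m (λ i → w i ℚ.* dilatedCoord V t i j) ≡ ℤ→ℚ (lookup z j)
    w-coord j = begin
      sumℚ m (λ i → w i ℚ.* dilatedCoord V t i j)
        ≡⟨ sumℚ-cong m (λ i → trans (reassoc (ℤ→ℚ (n i)) (1/suc d) (ℕ→ℚ t) (ℤ→ℚ (lookup (V i) j)))
             (cong (ℚ._* 1/suc d) (sym (homo (n i) (lookup (V i) j))))) ⟩
      sumℚ m (λ i → ℤ→ℚ (n i ℤ.* (+ t ℤ.* lookup (V i) j)) ℚ.* 1/suc d)
        ≡⟨ sumℚ-*ʳ m (1/suc d) _ ⟨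
      sumℚ m (λ i → ℤ→ℚ (n i ℤ.* (+ t ℤ.* lookup (V i) j))) ℚ.* 1/suc d
        ≡⟨ cong (ℚ._* 1/suc d) (trans (sym (ℤ→ℚ-homo-sum m _)) (cong ℤ→ℚ (n-coord j))) ⟩
      ℤ→ℚ (+ suc d ℤ.* lookup z j) ℚ.* 1/suc d
        ≡⟨ cong (ℚ._* 1/suc d) (ℤ→ℚ-homo-* (+ suc d) (lookup z j)) ⟩
      ℕ→ℚ (suc d) ℚ.* ℤ→ℚ (lookup z j) ℚ.* 1/suc d
        ≡⟨ cancel (ℕ→ℚ (suc d)) (ℤ→ℚ (lookup z j)) (1/suc d) ⟩
      1/suc d ℚ.* ℕ→ℚ (suc d) ℚ.* ℤ→ℚ (lookup z j)
        ≡⟨ trans (cong (ℚ._* ℤ→ℚ (lookup z j)) (1/suc-inverse d)) (ℚP.*-identityˡ _) ⟩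
      ℤ→ℚ (lookup z j) ∎
      where
      open ≡-Reasoning
      homo : ∀ a b → ℤ→ℚ (a ℤ.* (+ t ℤ.* b)) ≡ ℤ→ℚ a ℚ.* (ℕ→ℚ t ℚ.* ℤ→ℚ b)
      homo a b = trans (ℤ→ℚ-homo-* a (+ t ℤ.* b)) (cong (ℤ→ℚ a ℚ.*_) (ℤ→ℚ-homo-* (+ t) b))
      reassoc : ∀ a r b c → a ℚ.* r ℚ.* (b ℚ.* c) ≡ a ℚ.* (b ℚ.* c) ℚ.* r
      reassoc = RingSolver.solve-∀ ℚ-ring
      cancel : ∀ a b r → a ℚ.* b ℚ.* r ≡ r ℚ.* a ℚ.* b
      cancel = RingSolver.solve-∀ ℚ-ring

prodVertices : ∀ {N₁ N₂ m₁ m₂} → (Fin m₁ → Point N₁) → (Fin m₂ → Point N₂) →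
               Fin (m₁ * m₂) → Point (N₁ + N₂)
prodVertices {m₂ = m₂} V₁ V₂ k = uncurry (λ i j → V₁ i ++ V₂ j) (remQuot m₂ k)

module _ {N₁ N₂ m₁ m₂ : ℕ} (V₁ : Fin m₁ → Point N₁) (V₂ : Fin m₂ → Point N₂) where

  private
    V : Fin (m₁ * m₂) → Point (N₁ + N₂)
    V = prodVertices V₁ V₂

  prodVertices-combine : ∀ i j → V (combine i j) ≡ V₁ i ++ V₂ j
  prodVertices-combine i j = cong (uncurry (λ i j → V₁ i ++ V₂ j)) (FinP.remQuot-combine i j)

  dilatedCoord-↑ˡ : ∀ t i j (k : Fin N₁) → dilatedCoord V t (combine i j) (k ↑ˡ N₂) ≡ dilatedCoord V₁ t i k
  dilatedCoord-↑ˡ t i j k = cong (λ v → ℕ→ℚ t ℚ.* ℤ→ℚ v)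
    (trans (cong (λ p → lookup p (k ↑ˡ N₂)) (prodVertices-combine i j)) (VecP.lookup-++ˡ (V₁ i) (V₂ j) k))

  dilatedCoord-↑ʳ : ∀ t i j (k : Fin N₂) → dilatedCoord V t (combine i j) (N₁ ↑ʳ k) ≡ dilatedCoord V₂ t j k
  dilatedCoord-↑ʳ t i j k = cong (λ v → ℕ→ℚ t ℚ.* ℤ→ℚ v)
    (trans (cong (λ p → lookup p (N₁ ↑ʳ k)) (prodVertices-combine i j)) (VecP.lookup-++ʳ (V₁ i) (V₂ j) k))

  InDilate-prod⁻ : ∀ t x y → InDilate V t (x ++ y) → InDilate V₁ t x × InDilate V₂ t y
  InDilate-prod⁻ t x y (w , w≥0 , w-sum , w-coord) =
    (rows , (λ i → sumℚ-nonNeg m₂ _ (λ j → w≥0 _)) , trans (sym (sumℚ-combine m₁ m₂ w)) w-sum ,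
      λ k → trans (sym (sumℚ-rows w _ _ (λ i j → dilatedCoord-↑ˡ t i j k)))
                  (trans (w-coord (k ↑ˡ N₂)) (cong ℤ→ℚ (VecP.lookup-++ˡ x y k)))) ,
    (cols , (λ j → sumℚ-nonNeg m₁ _ (λ i → w≥0 _)) , trans (sym (sumℚ-combine-comm m₁ m₂ w)) w-sum ,
      λ k → trans (sym (sumℚ-cols w _ _ (λ i j → dilatedCoord-↑ʳ t i j k)))
                  (trans (w-coord (N₁ ↑ʳ k)) (cong ℤ→ℚ (VecP.lookup-++ʳ x y k))))
    where
    rows : Fin m₁ → ℚ
    rows i = sumℚ m₂ (λ j → w (combine i j))
    cols : Fin m₂ → ℚ
    cols j = sumℚ m₁ (λ i → w (combine i j))

  InDilate-prod⁺ : ∀ t x y → InDilate V₁ t x → InDilate V₂ t y → InDilate V t (x ++ y)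
  InDilate-prod⁺ t x y (u , u≥0 , u-sum , u-coord) (v , v≥0 , v-sum , v-coord) =
    w , (λ k → *-nonNeg (u≥0 _) (v≥0 _)) , w-sum , ↑-induction _ coordˡ coordʳ
    where
    w : Fin (m₁ * m₂) → ℚ
    w k = uncurry (λ i j → u i ℚ.* v j) (remQuot m₂ k)
    w-combine : ∀ i j → w (combine i j) ≡ u i ℚ.* v j
    w-combine i j = cong (uncurry (λ i j → u i ℚ.* v j)) (FinP.remQuot-combine i j)
    row : ∀ i → sumℚ m₂ (λ j → w (combine i j)) ≡ u i
    row i = trans (sumℚ-cong m₂ (w-combine i))
      (trans (sym (sumℚ-*ˡ m₂ (u i) v)) (trans (cong (u i ℚ.*_) v-sum) (ℚP.*-identityʳ (u i))))
    col : ∀ j → sumℚ m₁ (λ i → w (combine i j)) ≡ v j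
    col j = trans (sumℚ-cong m₁ (λ i → trans (w-combine i j) (ℚP.*-comm (u i) (v j))))
      (trans (sym (sumℚ-*ˡ m₁ (v j) u)) (trans (cong (v j ℚ.*_) u-sum) (ℚP.*-identityʳ (v j))))
    w-sum : sumℚ (m₁ * m₂) w ≡ 1ℚ
    w-sum = trans (sumℚ-combine m₁ m₂ w) (trans (sumℚ-cong m₁ row) u-sum)
    coordˡ : ∀ k → sumℚ (m₁ * m₂) (λ l → w l ℚ.* dilatedCoord V t l (k ↑ˡ N₂)) ≡
                   ℤ→ℚ (lookup (x ++ y) (k ↑ˡ N₂))
    coordˡ k = trans (sumℚ-rows w _ _ (λ i j → dilatedCoord-↑ˡ t i j k))
      (trans (sumℚ-cong m₁ (λ i → cong (ℚ._* dilatedCoord V₁ t i k) (row i)))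
      (trans (u-coord k) (cong ℤ→ℚ (sym (VecP.lookup-++ˡ x y k)))))
    coordʳ : ∀ k → sumℚ (m₁ * m₂) (λ l → w l ℚ.* dilatedCoord V t l (N₁ ↑ʳ k)) ≡
                   ℤ→ℚ (lookup (x ++ y) (N₁ ↑ʳ k))
    coordʳ k = trans (sumℚ-cols w _ _ (λ i j → dilatedCoord-↑ʳ t i j k))
      (trans (sumℚ-cong m₂ (λ j → cong (ℚ._* dilatedCoord V₂ t j k) (col j)))
      (trans (v-coord k) (cong ℤ→ℚ (sym (VecP.lookup-++ʳ x y k)))))

  LatticeCount-prod : ∀ t {a b} → LatticeCount V₁ t a → LatticeCount V₂ t b → LatticeCount V t (a * b)
  LatticeCount-prod t count₁ count₂ =
    HasSize-resp-⇔ (λ z → mk⇔ to (from z)) (HasSize-image (uncurry _++_) ++-injective (HasSize-× count₁ count₂))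
    where
    ++-injective : ∀ {p q : Point N₁ × Point N₂} → uncurry _++_ p ≡ uncurry _++_ q → p ≡ q
    ++-injective {x , y} {x′ , y′} eq = cong₂ _,_ (VecP.++-injectiveˡ x x′ eq) (VecP.++-injectiveʳ x x′ eq)
    to : ∀ {z} → (∃ λ p → (InDilate V₁ t (proj₁ p) × InDilate V₂ t (proj₂ p)) × z ≡ uncurry _++_ p) → InDilate V t z
    to ((x , y) , (x∈ , y∈) , refl) = InDilate-prod⁺ t x y x∈ y∈
    from : ∀ z → InDilate V t z → ∃ λ p → (InDilate V₁ t (proj₁ p) × InDilate V₂ t (proj₂ p)) × z ≡ uncurry _++_ p
    from z z∈ with Vec.splitAt N₁ z
    ... | x , y , refl = (x , y) , InDilate-prod⁻ t x y z∈ , refl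

-- Affine independence

dot : ∀ {n} → (Fin n → ℤ) → (Fin n → ℤ) → ℤ
dot e x = ℤΣ.sum (λ i → e i ℤ.* x i)

dot-removeAt : ∀ {n} (p : Fin (suc n)) (e x : Fin (suc n) → ℤ) →
               dot e x ≡ e p ℤ.* x p ℤ.+ dot (e ∘ punchIn p) (x ∘ punchIn p)
dot-removeAt p e x = ℤΣ.sum-remove {i = p} (λ i → e i ℤ.* x i)

dot-*ʳ : ∀ {n} c (e y : Fin n → ℤ) → dot e (λ i → c ℤ.* y i) ≡ c ℤ.* dot e y
dot-*ʳ c e y = trans (ℤΣ.sum-cong-≗ (λ i → swap (e i) c (y i))) (sym (ℤΣ.*-distribˡ-sum c (λ i → e i ℤ.* y i)))
  where
  swap : ∀ e c y → e ℤ.* (c ℤ.* y) ≡ c ℤ.* (e ℤ.* y)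
  swap = ℤSolver.solve-∀

dot-linear : ∀ {n} a b (e f y : Fin n → ℤ) →
             dot (λ i → a ℤ.* e i ℤ.- b ℤ.* f i) y ≡ a ℤ.* dot e y ℤ.- b ℤ.* dot f y
dot-linear a b e f y = begin
  dot (λ i → a ℤ.* e i ℤ.- b ℤ.* f i) y
    ≡⟨ ℤΣ.sum-cong-≗ (λ i → distrib a b (e i) (f i) (y i)) ⟩
  ℤΣ.sum (λ i → a ℤ.* (e i ℤ.* y i) ℤ.+ ℤ.- b ℤ.* (f i ℤ.* y i))
    ≡⟨ ℤΣ.∑-distrib-+ (λ i → a ℤ.* (e i ℤ.* y i)) (λ i → ℤ.- b ℤ.* (f i ℤ.* y i)) ⟩
  ℤΣ.sum (λ i → a ℤ.* (e i ℤ.* y i)) ℤ.+ ℤΣ.sum (λ i → ℤ.- b ℤ.* (f i ℤ.* y i))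
    ≡⟨ sym (cong₂ ℤ._+_ (ℤΣ.*-distribˡ-sum a (λ i → e i ℤ.* y i))
                        (ℤΣ.*-distribˡ-sum (ℤ.- b) (λ i → f i ℤ.* y i))) ⟩
  a ℤ.* dot e y ℤ.+ ℤ.- b ℤ.* dot f y
    ≡⟨ cong (λ v → a ℤ.* dot e y ℤ.+ v) (sym (ℤP.neg-distribˡ-* b (dot f y))) ⟩
  a ℤ.* dot e y ℤ.- b ℤ.* dot f y ∎
  where
  open ≡-Reasoning
  distrib : ∀ a b e f y → (a ℤ.* e ℤ.- b ℤ.* f) ℤ.* y ≡ a ℤ.* (e ℤ.* y) ℤ.+ ℤ.- b ℤ.* (f ℤ.* y)
  distrib = ℤSolver.solve-∀

NontrivialSolution : ∀ {R n} → (Fin R → Fin n → ℤ) → Set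
NontrivialSolution {n = n} E = ∃ λ (x : Fin n → ℤ) → (∀ r → dot (E r) x ≡ + 0) × ∃ λ i → x i ≢ + 0

-- Row reduction by cross-multiplication, so that no division leaves ℤ.
eliminate : ∀ {R n} → (Fin (suc R) → Fin (suc n) → ℤ) → Fin (suc n) → Fin R → Fin n → ℤ
eliminate E p r i = E zero p ℤ.* E (suc r) (punchIn p i) ℤ.- E (suc r) p ℤ.* E zero (punchIn p i)

module _ {R n} (E : Fin (suc R) → Fin (suc n) → ℤ) where

  NontrivialSolution-zeroRow : (∀ i → E zero i ≡ + 0) →
    NontrivialSolution (λ r i → E (suc r) (suc i)) → NontrivialSolution E
  NontrivialSolution-zeroRow row₀≡0 (y , y-solves , i , yi≢0) = x , solves , suc i , yi≢0
    where
    x : Fin (suc n) → ℤ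
    x = insertAt y zero (+ 0)
    solves : ∀ r → dot (E r) x ≡ + 0
    solves zero    = trans (ℤΣ.sum-cong-≗ (λ i → trans (cong (ℤ._* x i) (row₀≡0 i)) (ℤP.*-zeroˡ (x i))))
                           (ℤΣ.sum-replicate-zero (suc n))
    solves (suc r) = trans (cong₂ ℤ._+_ (ℤP.*-zeroʳ (E (suc r) zero)) (y-solves r)) refl

  NontrivialSolution-pivot : ∀ p → E zero p ≢ + 0 →
    NontrivialSolution (eliminate E p) → NontrivialSolution E
  NontrivialSolution-pivot p ap≢0 (y , y-solves , i , yi≢0) = x , solves , punchIn p i , xi≢0
    where
    a : Fin (suc n) → ℤ
    a = E zero
    S : ℤ
    S = dot (a ∘ punchIn p) y
    x : Fin (suc n) → ℤ
    x = insertAt (λ i → a p ℤ.* y i) p (ℤ.- S)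
    x∘punchIn : ∀ i → x (punchIn p i) ≡ a p ℤ.* y i
    x∘punchIn = VecFP.insertAt-punchIn (λ i → a p ℤ.* y i) p (ℤ.- S)
    dot-x : ∀ e → dot e x ≡ e p ℤ.* ℤ.- S ℤ.+ a p ℤ.* dot (e ∘ punchIn p) y
    dot-x e = begin
      dot e x                                                   ≡⟨ dot-removeAt p e x ⟩
      e p ℤ.* x p ℤ.+ dot (e ∘ punchIn p) (x ∘ punchIn p)
        ≡⟨ cong₂ (λ u v → e p ℤ.* u ℤ.+ v) (VecFP.insertAt-lookup (λ i → a p ℤ.* y i) p (ℤ.- S))
                 (ℤΣ.sum-cong-≗ (λ i → cong (e (punchIn p i) ℤ.*_) (x∘punchIn i))) ⟩
      e p ℤ.* ℤ.- S ℤ.+ dot (e ∘ punchIn p) (λ i → a p ℤ.* y i)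
        ≡⟨ cong (λ v → e p ℤ.* ℤ.- S ℤ.+ v) (dot-*ʳ (a p) (e ∘ punchIn p) y) ⟩
      e p ℤ.* ℤ.- S ℤ.+ a p ℤ.* dot (e ∘ punchIn p) y ∎
      where open ≡-Reasoning
    solves : ∀ r → dot (E r) x ≡ + 0
    solves zero    = trans (dot-x a) (cancel (a p) S)
      where
      cancel : ∀ a S → a ℤ.* ℤ.- S ℤ.+ a ℤ.* S ≡ + 0
      cancel = ℤSolver.solve-∀
    solves (suc r) = trans (dot-x (E (suc r)))
      (trans (swap (E (suc r) p) S (a p) _)
      (trans (sym (dot-linear (a p) (E (suc r) p) (E (suc r) ∘ punchIn p) (a ∘ punchIn p) y)) (y-solves r)))
      where
      swap : ∀ e S a T → e ℤ.* ℤ.- S ℤ.+ a ℤ.* T ≡ a ℤ.* T ℤ.- e ℤ.* S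
      swap = ℤSolver.solve-∀
    xi≢0 : x (punchIn p i) ≢ + 0
    xi≢0 xi≡0 with ℤP.i*j≡0⇒i≡0∨j≡0 (a p) (trans (sym (x∘punchIn i)) xi≡0)
    ... | inj₁ ap≡0 = ap≢0 ap≡0
    ... | inj₂ yi≡0 = yi≢0 yi≡0

underdetermined-solution : ∀ R (E : Fin R → Fin (suc R) → ℤ) → NontrivialSolution E
underdetermined-solution zero    E = (λ _ → + 1) , (λ ()) , zero , (λ ())
underdetermined-solution (suc R) E with FinP.all? (λ i → E zero i ℤP.≟ + 0)
... | yes row₀≡0 = NontrivialSolution-zeroRow E row₀≡0 (underdetermined-solution R (λ r i → E (suc r) (suc i)))
... | no  row₀≢0 = NontrivialSolution-pivot E p ap≢0 (underdetermined-solution R (eliminate E p))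
  where
  pivot : ∃ λ p → E zero p ≢ + 0
  pivot = FinP.¬∀⟶∃¬ _ _ (λ i → E zero i ℤP.≟ + 0) row₀≢0
  p : Fin (suc (suc R))
  p = proj₁ pivot
  ap≢0 : E zero p ≢ + 0
  ap≢0 = proj₂ pivot

affineSystem : ∀ {d k} → (Fin k → Point d) → Fin (suc d) → Fin k → ℤ
affineSystem p zero    l = + 1
affineSystem p (suc j) l = lookup (p l) j

¬AffIndep-d+2 : ∀ d (p : Fin (suc (suc d)) → Point d) → ¬ AffIndep p
¬AffIndep-d+2 d p indep with underdetermined-solution (suc d) (affineSystem p)
... | x , solves , i , xi≢0 = xi≢0 (ℤ→ℚ-injective (indep (ℤ→ℚ ∘ x) c-sum c-coord i))
  where
  c-sum : sumℚ (suc (suc d)) (ℤ→ℚ ∘ x) ≡ 0ℚ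
  c-sum = trans (sym (ℤ→ℚ-homo-sum _ x))
    (cong ℤ→ℚ (trans (ℤΣ.sum-cong-≗ (λ l → sym (ℤP.*-identityˡ (x l)))) (solves zero)))
  c-coord : ∀ j → sumℚ (suc (suc d)) (λ l → ℤ→ℚ (x l) ℚ.* ℤ→ℚ (lookup (p l) j)) ≡ 0ℚ
  c-coord j = trans (sumℚ-cong _ (λ l → sym (ℤ→ℚ-homo-* (x l) (lookup (p l) j))))
    (trans (sym (ℤ→ℚ-homo-sum _ (λ l → x l ℤ.* lookup (p l) j)))
    (cong ℤ→ℚ (trans (ℤΣ.sum-cong-≗ (λ l → ℤP.*-comm (x l) (lookup (p l) j))) (solves (suc j)))))

prodChoice : ∀ {m₁ m₂ d₁ d₂} → (Fin (suc d₁) → Fin m₁) → (Fin (suc d₂) → Fin m₂) →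
             Fin (suc (d₁ + d₂)) → Fin (m₁ * m₂)
prodChoice {d₁ = d₁} f₁ f₂ =
  [ (λ i → combine (f₁ i) (f₂ zero)) , (λ j → combine (f₁ zero) (f₂ (suc j))) ]′ ∘ splitAt (suc d₁)

module _ {N₁ N₂ m₁ m₂ d₁ d₂ : ℕ} (V₁ : Fin m₁ → Point N₁) (V₂ : Fin m₂ → Point N₂)
         (f₁ : Fin (suc d₁) → Fin m₁) (f₂ : Fin (suc d₂) → Fin m₂) where

  private
    P : Fin (suc (d₁ + d₂)) → Point (N₁ + N₂)
    P = prodVertices V₁ V₂ ∘ prodChoice f₁ f₂

    P-↑ˡ : ∀ i → P (i ↑ˡ d₂) ≡ V₁ (f₁ i) ++ V₂ (f₂ zero)
    P-↑ˡ i = trans (cong (prodVertices V₁ V₂ ∘ [ _ , _ ]′) (FinP.splitAt-↑ˡ (suc d₁) i d₂))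
                   (prodVertices-combine V₁ V₂ (f₁ i) (f₂ zero))

    P-↑ʳ : ∀ j → P (suc d₁ ↑ʳ j) ≡ V₁ (f₁ zero) ++ V₂ (f₂ (suc j))
    P-↑ʳ j = trans (cong (prodVertices V₁ V₂ ∘ [ _ , _ ]′) (FinP.splitAt-↑ʳ (suc d₁) d₂ j))
                   (prodVertices-combine V₁ V₂ (f₁ zero) (f₂ (suc j)))

    coord : Fin (suc (d₁ + d₂)) → Fin (N₁ + N₂) → ℚ
    coord l k = ℤ→ℚ (lookup (P l) k)

    coord-ˡˡ : ∀ i k → coord (i ↑ˡ d₂) (k ↑ˡ N₂) ≡ ℤ→ℚ (lookup (V₁ (f₁ i)) k)
    coord-ˡˡ i k = cong ℤ→ℚ (trans (cong (λ p → lookup p (k ↑ˡ N₂)) (P-↑ˡ i))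
                                   (VecP.lookup-++ˡ (V₁ (f₁ i)) (V₂ (f₂ zero)) k))

    coord-ˡʳ : ∀ i k → coord (i ↑ˡ d₂) (N₁ ↑ʳ k) ≡ ℤ→ℚ (lookup (V₂ (f₂ zero)) k)
    coord-ˡʳ i k = cong ℤ→ℚ (trans (cong (λ p → lookup p (N₁ ↑ʳ k)) (P-↑ˡ i))
                                   (VecP.lookup-++ʳ (V₁ (f₁ i)) (V₂ (f₂ zero)) k))

    coord-ʳʳ : ∀ j k → coord (suc d₁ ↑ʳ j) (N₁ ↑ʳ k) ≡ ℤ→ℚ (lookup (V₂ (f₂ (suc j))) k)
    coord-ʳʳ j k = cong ℤ→ℚ (trans (cong (λ p → lookup p (N₁ ↑ʳ k)) (P-↑ʳ j))
                                   (VecP.lookup-++ʳ (V₁ (f₁ zero)) (V₂ (f₂ (suc j))) k))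

  -- Given a dependency c, the second-factor coordinates make (Σ cˡ, cʳ) a dependency of V₂ ∘ f₂, so
  -- cʳ = 0 and Σ cˡ = 0; the first-factor coordinates then make cˡ a dependency of V₁ ∘ f₁.
  AffIndep-prod : AffIndep (V₁ ∘ f₁) → AffIndep (V₂ ∘ f₂) → AffIndep P
  AffIndep-prod indep₁ indep₂ c c-sum c-coord = ↑-induction _ cˡ≡0 (λ j → c₂≡0 (suc j))
    where
    cˡ : Fin (suc d₁) → ℚ
    cˡ = c ∘ (_↑ˡ d₂)
    cʳ : Fin d₂ → ℚ
    cʳ = c ∘ (suc d₁ ↑ʳ_)
    A : ℚ
    A = sumℚ (suc d₁) cˡ
    A+B≡0 : A ℚ.+ sumℚ d₂ cʳ ≡ 0ℚ
    A+B≡0 = trans (sym (sumℚ-↑ (suc d₁) d₂ c)) c-sum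
    coord-split : ∀ k → sumℚ (suc d₁) (λ i → cˡ i ℚ.* coord (i ↑ˡ d₂) k) ℚ.+
                        sumℚ d₂ (λ j → cʳ j ℚ.* coord (suc d₁ ↑ʳ j) k) ≡ 0ℚ
    coord-split k = trans (sym (sumℚ-↑ (suc d₁) d₂ (λ l → c l ℚ.* coord l k))) (c-coord k)
    c₂ : Fin (suc d₂) → ℚ
    c₂ zero    = A
    c₂ (suc j) = cʳ j
    c₂≡0 : ∀ j → c₂ j ≡ 0ℚ
    c₂≡0 = indep₂ c₂ A+B≡0 λ k → trans
      (cong₂ ℚ._+_ (trans (sumℚ-*ʳ (suc d₁) _ cˡ)
                          (sumℚ-cong (suc d₁) (λ i → cong (cˡ i ℚ.*_) (sym (coord-ˡʳ i k)))))
                   (sumℚ-cong d₂ (λ j → cong (cʳ j ℚ.*_) (sym (coord-ʳʳ j k)))))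
      (coord-split (N₁ ↑ʳ k))
    cʳ-terms≡0 : ∀ k → sumℚ d₂ (λ j → cʳ j ℚ.* coord (suc d₁ ↑ʳ j) k) ≡ 0ℚ
    cʳ-terms≡0 k = trans (sumℚ-cong d₂ λ j → trans (cong (ℚ._* coord (suc d₁ ↑ʳ j) k) (c₂≡0 (suc j)))
                                                   (ℚP.*-zeroˡ (coord (suc d₁ ↑ʳ j) k)))
                         (sumℚ-zero d₂)
    cˡ≡0 : ∀ i → cˡ i ≡ 0ℚ
    cˡ≡0 = indep₁ cˡ (c₂≡0 zero) λ k → trans (sym (ℚP.+-identityʳ _))
      (trans (cong₂ ℚ._+_ (sumℚ-cong (suc d₁) (λ i → cong (cˡ i ℚ.*_) (sym (coord-ˡˡ i k))))
                          (sym (cʳ-terms≡0 (k ↑ˡ N₂))))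
             (coord-split (k ↑ˡ N₂)))

-- The cube [0, L]^N

origin : Fin 1 → Point 0
origin _ = []

LatticeCount-origin : ∀ t → LatticeCount origin t 1
LatticeCount-origin t =
  [] List.∷ List.[] , All.[] AllPairs.∷ AllPairs.[] ,
  (λ { [] → mk⇔ (λ _ → (λ _ → 1ℚ) , (λ _ → ℚP.nonNegative⁻¹ 1ℚ) , refl , λ ()) (λ _ → here refl) }) ,
  refl

AffIndep-origin : AffIndep origin
AffIndep-origin c c-sum _ zero = trans (sym (ℚP.+-identityʳ (c zero))) c-sum

segment : ℕ → Fin 2 → Point 1
segment L zero       = + 0 ∷ []
segment L (suc zero) = + L ∷ []

module _ (L t : ℕ) .{{_ : ℕ.NonZero L}} .{{_ : ℕ.NonZero t}} where

  InDilate-segment : ∀ z → InDilate (segment L) t (z ∷ []) ⇔ (+ 0 ℤ.≤ z × z ℤ.≤ + (t * L))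
  InDilate-segment z = mk⇔ to from
    where
    tL≡t*L : + (t * L) ≡ + t ℤ.* + L
    tL≡t*L = ℤP.pos-* t L
    to : InDilate (segment L) t (z ∷ []) → + 0 ℤ.≤ z × z ℤ.≤ + (t * L)
    to (w , w≥0 , w-sum , w-coord) =
      ℤ→ℚ-gap⇒≤ {a = + 0} (trans (sym (w-coord zero)) (lower (w zero) (w (suc zero)) T L′))
                   (*-nonNeg (ℕ→ℚ-nonNeg t) (ℕ→ℚ-nonNeg L)) (w≥0 (suc zero)) ,
      ℤ→ℚ-gap⇒≤ {a = z} (begin
        ℤ→ℚ (+ (t * L))               ≡⟨ trans (cong ℤ→ℚ tL≡t*L) (ℤ→ℚ-homo-* (+ t) (+ L)) ⟩
        T ℚ.* L′                      ≡⟨ ℚP.*-identityʳ (T ℚ.* L′) ⟨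
        T ℚ.* L′ ℚ.* 1ℚ               ≡⟨ cong (T ℚ.* L′ ℚ.*_) w-sum ⟨
        T ℚ.* L′ ℚ.* sumℚ 2 w         ≡⟨ upper (w zero) (w (suc zero)) T L′ ⟩
        sumℚ 2 (λ i → w i ℚ.* dilatedCoord (segment L) t i zero) ℚ.+ T ℚ.* L′ ℚ.* w zero
                                      ≡⟨ cong (ℚ._+ T ℚ.* L′ ℚ.* w zero) (w-coord zero) ⟩
        ℤ→ℚ z ℚ.+ T ℚ.* L′ ℚ.* w zero ∎)
        (*-nonNeg (ℕ→ℚ-nonNeg t) (ℕ→ℚ-nonNeg L)) (w≥0 zero)
      where
      open ≡-Reasoning
      T L′ : ℚ
      T = ℕ→ℚ t
      L′ = ℕ→ℚ L
      lower : ∀ w₀ w₁ T L → w₀ ℚ.* (T ℚ.* 0ℚ) ℚ.+ (w₁ ℚ.* (T ℚ.* L) ℚ.+ 0ℚ) ≡ 0ℚ ℚ.+ T ℚ.* L ℚ.* w₁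
      lower = RingSolver.solve-∀ ℚ-ring
      upper : ∀ w₀ w₁ T L → T ℚ.* L ℚ.* (w₀ ℚ.+ (w₁ ℚ.+ 0ℚ)) ≡
              (w₀ ℚ.* (T ℚ.* 0ℚ) ℚ.+ (w₁ ℚ.* (T ℚ.* L) ℚ.+ 0ℚ)) ℚ.+ T ℚ.* L ℚ.* w₀
      upper = RingSolver.solve-∀ ℚ-ring
    from : + 0 ℤ.≤ z × z ℤ.≤ + (t * L) → InDilate (segment L) t (z ∷ [])
    from (0≤z , z≤tL) = InDilate-fromIntegerWeights (segment L) t (t * L) {{ℕP.m*n≢0 t L}} (z ∷ []) n n≥0
      (sum≡ (+ (t * L)) z) (λ { zero → trans (coord≡ (+ (t * L)) z (+ t) (+ L)) (cong (ℤ._* z) (sym tL≡t*L)) })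
      where
      n : Fin 2 → ℤ
      n zero       = + (t * L) ℤ.- z
      n (suc zero) = z
      n≥0 : ∀ i → + 0 ℤ.≤ n i
      n≥0 zero       = ℤP.i≤j⇒0≤j-i z≤tL
      n≥0 (suc zero) = 0≤z
      sum≡ : ∀ D z → D ℤ.- z ℤ.+ (z ℤ.+ + 0) ≡ D
      sum≡ = ℤSolver.solve-∀
      coord≡ : ∀ D z t L → (D ℤ.- z) ℤ.* (t ℤ.* + 0) ℤ.+ (z ℤ.* (t ℤ.* L) ℤ.+ + 0) ≡ t ℤ.* L ℤ.* z
      coord≡ = ℤSolver.solve-∀

  LatticeCount-segment : LatticeCount (segment L) t (suc (t * L))
  LatticeCount-segment = HasSize-resp-⇔ {Q = InDilate (segment L) t} (λ z → mk⇔ to (from z))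
    (HasSize-image (λ i → + i ∷ []) singleton-injective (HasSize-< (suc (t * L))))
    where
    singleton-injective : ∀ {i j} → (+ i ∷ []) ≡ (+ j ∷ []) → i ≡ j
    singleton-injective refl = refl
    to : ∀ {z} → (∃ λ i → i < suc (t * L) × z ≡ (+ i ∷ [])) → InDilate (segment L) t z
    to (i , i<1+tL , refl) = Equivalence.from (InDilate-segment (+ i)) (ℤ.+≤+ z≤n , ℤ.+≤+ (ℕ.s≤s⁻¹ i<1+tL))
    from : ∀ z → InDilate (segment L) t z → ∃ λ i → i < suc (t * L) × z ≡ (+ i ∷ [])
    from (z ∷ []) z∈ = natural (Equivalence.to (InDilate-segment z) z∈)
      where
      natural : + 0 ℤ.≤ z × z ℤ.≤ + (t * L) → ∃ λ i → i < suc (t * L) × (z ∷ []) ≡ (+ i ∷ [])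
      natural (ℤ.+≤+ _ , z≤tL) = _ , s≤s (ℤP.drop‿+≤+ z≤tL) , refl

AffIndep-segment : ∀ L → AffIndep (segment (suc L))
AffIndep-segment L c c-sum c-coord = λ { zero → c₀≡0 ; (suc zero) → c₁≡0 }
  where
  c₁≡0 : c (suc zero) ≡ 0ℚ
  c₁≡0 = p*[1+d]≡0⇒p≡0 (c (suc zero)) L (trans (isolate (c zero) (c (suc zero)) (ℕ→ℚ (suc L))) (c-coord zero))
    where
    isolate : ∀ c₀ c₁ l → c₁ ℚ.* l ≡ c₀ ℚ.* 0ℚ ℚ.+ (c₁ ℚ.* l ℚ.+ 0ℚ)
    isolate = RingSolver.solve-∀ ℚ-ring
  c₀≡0 : c zero ≡ 0ℚ
  c₀≡0 = trans (sym (ℚP.+-identityʳ (c zero)))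
    (trans (cong (λ v → c zero ℚ.+ v) (trans (sym c₁≡0) (sym (ℚP.+-identityʳ (c (suc zero)))))) c-sum)

box : ℕ → (N : ℕ) → Fin (2 ^ N) → Point N
box L zero    = origin
box L (suc N) = prodVertices (segment L) (box L N)

LatticeCount-box : ∀ L N t .{{_ : ℕ.NonZero L}} .{{_ : ℕ.NonZero t}} → LatticeCount (box L N) t (suc (t * L) ^ N)
LatticeCount-box L zero    t = LatticeCount-origin t
LatticeCount-box L (suc N) t = LatticeCount-prod (segment L) (box L N) t (LatticeCount-segment L t) (LatticeCount-box L N t)

boxChoice : ∀ N → Fin (suc N) → Fin (2 ^ N)
boxChoice zero    = id
boxChoice (suc N) = prodChoice {d₁ = 1} id (boxChoice N)

AffIndep-box : ∀ L N → AffIndep (λ i → box (suc L) N (boxChoice N i))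
AffIndep-box L zero    = AffIndep-origin
AffIndep-box L (suc N) = AffIndep-prod (segment (suc L)) (box (suc L) N) id (boxChoice N) (AffIndep-segment L) (AffIndep-box L N)

-- The Reeve tetrahedron

reeve : ℕ → ℕ → Fin 4 → Point 3
reeve s m zero                   = + 0 ∷ + 0 ∷ + 0 ∷ []
reeve s m (suc zero)             = + s ∷ + 0 ∷ + 0 ∷ []
reeve s m (suc (suc zero))       = + 0 ∷ + s ∷ + 0 ∷ []
reeve s m (suc (suc (suc zero))) = + s ∷ + s ∷ + s ℤ.* + m ∷ []

ReevePoint : ℕ → ℕ → ℕ × ℕ × ℕ → Set
ReevePoint m u (x , y , h) = h ≤ m * x × h ≤ m * y × m * x + m * y ≤ m * u + h

toPoint : ℕ × ℕ × ℕ → Point 3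
toPoint (x , y , h) = + x ∷ + y ∷ + h ∷ []

toPoint-injective : ∀ {p q} → toPoint p ≡ toPoint q → p ≡ q
toPoint-injective {x , y , h} {.x , .y , .h} refl = refl

0≤m*x⇒0≤x : ∀ m .{{_ : ℕ.NonZero m}} x → + 0 ℤ.≤ + m ℤ.* x → + 0 ℤ.≤ x
0≤m*x⇒0≤x (suc m) (+ x)    _  = ℤ.+≤+ z≤n
0≤m*x⇒0≤x (suc m) -[1+ x ] ()

module _ (s m t : ℕ) .{{_ : ℕ.NonZero s}} .{{m≢0 : ℕ.NonZero m}} .{{_ : ℕ.NonZero t}} where

  ReeveFacets : ℤ → ℤ → ℤ → Set
  ReeveFacets x y h =
    + 0 ℤ.≤ h × h ℤ.≤ + m ℤ.* x × h ℤ.≤ + m ℤ.* y × + m ℤ.* x ℤ.+ + m ℤ.* y ℤ.≤ + m ℤ.* + (t * s) ℤ.+ h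

  private
    T S M : ℚ
    T = ℕ→ℚ t
    S = ℕ→ℚ s
    M = ℕ→ℚ m

    module Barycentric (x y h : ℤ) (w : Fin 4 → ℚ)
      (w-coord : ∀ j → sumℚ 4 (λ i → w i ℚ.* dilatedCoord (reeve s m) t i j) ≡ ℤ→ℚ (lookup (x ∷ y ∷ h ∷ []) j))
      where
      w₀ w₁ w₂ w₃ : ℚ
      w₀ = w zero
      w₁ = w (suc zero)
      w₂ = w (suc (suc zero))
      w₃ = w (suc (suc (suc zero)))

      x≡ : ℤ→ℚ x ≡ T ℚ.* S ℚ.* (w₁ ℚ.+ w₃)
      x≡ = trans (sym (w-coord zero)) (coord₀ w₀ w₁ w₂ w₃ T S)
        where
        coord₀ : ∀ w₀ w₁ w₂ w₃ T S →
                 w₀ ℚ.* (T ℚ.* 0ℚ) ℚ.+ (w₁ ℚ.* (T ℚ.* S) ℚ.+ (w₂ ℚ.* (T ℚ.* 0ℚ) ℚ.+ (w₃ ℚ.* (T ℚ.* S) ℚ.+ 0ℚ))) ≡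
                 T ℚ.* S ℚ.* (w₁ ℚ.+ w₃)
        coord₀ = RingSolver.solve-∀ ℚ-ring

      y≡ : ℤ→ℚ y ≡ T ℚ.* S ℚ.* (w₂ ℚ.+ w₃)
      y≡ = trans (sym (w-coord (suc zero))) (coord₁ w₀ w₁ w₂ w₃ T S)
        where
        coord₁ : ∀ w₀ w₁ w₂ w₃ T S →
                 w₀ ℚ.* (T ℚ.* 0ℚ) ℚ.+ (w₁ ℚ.* (T ℚ.* 0ℚ) ℚ.+ (w₂ ℚ.* (T ℚ.* S) ℚ.+ (w₃ ℚ.* (T ℚ.* S) ℚ.+ 0ℚ))) ≡
                 T ℚ.* S ℚ.* (w₂ ℚ.+ w₃)
        coord₁ = RingSolver.solve-∀ ℚ-ring

      h≡ : ℤ→ℚ h ≡ T ℚ.* S ℚ.* M ℚ.* w₃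
      h≡ = trans (sym (w-coord (suc (suc zero))))
        (trans (cong (λ v → w₀ ℚ.* (T ℚ.* 0ℚ) ℚ.+ (w₁ ℚ.* (T ℚ.* 0ℚ) ℚ.+ (w₂ ℚ.* (T ℚ.* 0ℚ) ℚ.+ (w₃ ℚ.* (T ℚ.* v) ℚ.+ 0ℚ))))
                     (ℤ→ℚ-homo-* (+ s) (+ m)))
               (coord₂ w₀ w₁ w₂ w₃ T S M))
        where
        coord₂ : ∀ w₀ w₁ w₂ w₃ T S M →
                 w₀ ℚ.* (T ℚ.* 0ℚ) ℚ.+ (w₁ ℚ.* (T ℚ.* 0ℚ) ℚ.+ (w₂ ℚ.* (T ℚ.* 0ℚ) ℚ.+ (w₃ ℚ.* (T ℚ.* (S ℚ.* M)) ℚ.+ 0ℚ))) ≡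
                 T ℚ.* S ℚ.* M ℚ.* w₃
        coord₂ = RingSolver.solve-∀ ℚ-ring

    TSM≥0 : 0ℚ ℚ.≤ T ℚ.* S ℚ.* M
    TSM≥0 = *-nonNeg (*-nonNeg (ℕ→ℚ-nonNeg t) (ℕ→ℚ-nonNeg s)) (ℕ→ℚ-nonNeg m)

    MTS≥0 : 0ℚ ℚ.≤ M ℚ.* T ℚ.* S
    MTS≥0 = *-nonNeg (*-nonNeg (ℕ→ℚ-nonNeg m) (ℕ→ℚ-nonNeg t)) (ℕ→ℚ-nonNeg s)

  -- The facet functionals h, m·x − h, m·y − h and m·t·s + h − m·x − m·y are m·t·s times the
  -- barycentric coordinates with respect to the dilated vertices; this gives both inclusions.
  InDilate-reeve⁻ : ∀ x y h → InDilate (reeve s m) t (x ∷ y ∷ h ∷ []) → ReeveFacets x y h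
  InDilate-reeve⁻ x y h (w , w≥0 , w-sum , w-coord) =
    ℤ→ℚ-gap⇒≤ {a = + 0} (trans h≡ (sym (ℚP.+-identityˡ _))) TSM≥0 (w≥0 (suc (suc (suc zero)))) ,
    ℤ→ℚ-gap⇒≤ {a = h} (side x w₁ x≡) MTS≥0 (w≥0 (suc zero)) ,
    ℤ→ℚ-gap⇒≤ {a = h} (side y w₂ y≡) MTS≥0 (w≥0 (suc (suc zero))) ,
    ℤ→ℚ-gap⇒≤ {a = + m ℤ.* x ℤ.+ + m ℤ.* y} base MTS≥0 (w≥0 zero)
    where
    open Barycentric x y h w w-coord
    open ≡-Reasoning
    side : ∀ v wᵥ → ℤ→ℚ v ≡ T ℚ.* S ℚ.* (wᵥ ℚ.+ w₃) →
           ℤ→ℚ (+ m ℤ.* v) ≡ ℤ→ℚ h ℚ.+ M ℚ.* T ℚ.* S ℚ.* wᵥ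
    side v wᵥ v≡ = begin
      ℤ→ℚ (+ m ℤ.* v)                              ≡⟨ trans (ℤ→ℚ-homo-* (+ m) v) (cong (M ℚ.*_) v≡) ⟩
      M ℚ.* (T ℚ.* S ℚ.* (wᵥ ℚ.+ w₃))              ≡⟨ split T S M wᵥ w₃ ⟩
      T ℚ.* S ℚ.* M ℚ.* w₃ ℚ.+ M ℚ.* T ℚ.* S ℚ.* wᵥ ≡⟨ cong (ℚ._+ M ℚ.* T ℚ.* S ℚ.* wᵥ) h≡ ⟨
      ℤ→ℚ h ℚ.+ M ℚ.* T ℚ.* S ℚ.* wᵥ               ∎
      where
      split : ∀ T S M w w₃ → M ℚ.* (T ℚ.* S ℚ.* (w ℚ.+ w₃)) ≡ T ℚ.* S ℚ.* M ℚ.* w₃ ℚ.+ M ℚ.* T ℚ.* S ℚ.* w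
      split = RingSolver.solve-∀ ℚ-ring
    base : ℤ→ℚ (+ m ℤ.* + (t * s) ℤ.+ h) ≡ ℤ→ℚ (+ m ℤ.* x ℤ.+ + m ℤ.* y) ℚ.+ M ℚ.* T ℚ.* S ℚ.* w₀
    base = begin
      ℤ→ℚ (+ m ℤ.* + (t * s) ℤ.+ h)
        ≡⟨ trans (ℤ→ℚ-homo-+ (+ m ℤ.* + (t * s)) h) (cong (ℚ._+ ℤ→ℚ h) (ℤ→ℚ-homo-* (+ m) (+ (t * s)))) ⟩
      M ℚ.* ℕ→ℚ (t * s) ℚ.+ ℤ→ℚ h
        ≡⟨ cong₂ (λ u v → M ℚ.* u ℚ.+ v) (trans (cong ℤ→ℚ (ℤP.pos-* t s)) (ℤ→ℚ-homo-* (+ t) (+ s))) h≡ ⟩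
      M ℚ.* (T ℚ.* S) ℚ.+ T ℚ.* S ℚ.* M ℚ.* w₃
        ≡⟨ cong (λ v → v ℚ.+ T ℚ.* S ℚ.* M ℚ.* w₃)
                (trans (sym (ℚP.*-identityʳ (M ℚ.* (T ℚ.* S)))) (cong (M ℚ.* (T ℚ.* S) ℚ.*_) (sym w-sum))) ⟩
      M ℚ.* (T ℚ.* S) ℚ.* sumℚ 4 w ℚ.+ T ℚ.* S ℚ.* M ℚ.* w₃
        ≡⟨ regroup T S M w₀ w₁ w₂ w₃ ⟩
      M ℚ.* (T ℚ.* S ℚ.* (w₁ ℚ.+ w₃)) ℚ.+ M ℚ.* (T ℚ.* S ℚ.* (w₂ ℚ.+ w₃)) ℚ.+ M ℚ.* T ℚ.* S ℚ.* w₀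
        ≡⟨ cong (ℚ._+ M ℚ.* T ℚ.* S ℚ.* w₀) (sym (trans (ℤ→ℚ-homo-+ (+ m ℤ.* x) (+ m ℤ.* y))
             (cong₂ ℚ._+_ (trans (ℤ→ℚ-homo-* (+ m) x) (cong (M ℚ.*_) x≡))
                          (trans (ℤ→ℚ-homo-* (+ m) y) (cong (M ℚ.*_) y≡))))) ⟩
      ℤ→ℚ (+ m ℤ.* x ℤ.+ + m ℤ.* y) ℚ.+ M ℚ.* T ℚ.* S ℚ.* w₀ ∎
      where
      regroup : ∀ T S M w₀ w₁ w₂ w₃ →
                M ℚ.* (T ℚ.* S) ℚ.* (w₀ ℚ.+ (w₁ ℚ.+ (w₂ ℚ.+ (w₃ ℚ.+ 0ℚ)))) ℚ.+ T ℚ.* S ℚ.* M ℚ.* w₃ ≡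
                M ℚ.* (T ℚ.* S ℚ.* (w₁ ℚ.+ w₃)) ℚ.+ M ℚ.* (T ℚ.* S ℚ.* (w₂ ℚ.+ w₃)) ℚ.+ M ℚ.* T ℚ.* S ℚ.* w₀
      regroup = RingSolver.solve-∀ ℚ-ring

  InDilate-reeve⁺ : ∀ p → ReevePoint m (t * s) p → InDilate (reeve s m) t (toPoint p)
  InDilate-reeve⁺ (x , y , h) (h≤mx , h≤my , mx+my≤mu+h) =
    InDilate-fromIntegerWeights (reeve s m) t (m * (t * s)) {{ℕP.m*n≢0 m (t * s) {{m≢0}} {{ℕP.m*n≢0 t s}}}}
      (toPoint (x , y , h)) n n≥0 (trans (sum≡ M′ T′ S′ H X Y) (sym D≡))
      λ { zero             → trans (coord₀ M′ T′ S′ H X Y) (cong (ℤ._* X) (sym D≡))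
        ; (suc zero)       → trans (coord₁ M′ T′ S′ H X Y) (cong (ℤ._* Y) (sym D≡))
        ; (suc (suc zero)) → trans (coord₂ M′ T′ S′ H X Y) (cong (ℤ._* H) (sym D≡)) }
    where
    M′ T′ S′ X Y H : ℤ
    M′ = + m
    T′ = + t
    S′ = + s
    X = + x
    Y = + y
    H = + h
    D≡ : + (m * (t * s)) ≡ M′ ℤ.* (T′ ℤ.* S′)
    D≡ = trans (ℤP.pos-* m (t * s)) (cong (M′ ℤ.*_) (ℤP.pos-* t s))
    n : Fin 4 → ℤ
    n zero                   = M′ ℤ.* (T′ ℤ.* S′) ℤ.+ H ℤ.- (M′ ℤ.* X ℤ.+ M′ ℤ.* Y)
    n (suc zero)             = M′ ℤ.* X ℤ.- H
    n (suc (suc zero))       = M′ ℤ.* Y ℤ.- H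
    n (suc (suc (suc zero))) = H
    n≥0 : ∀ i → + 0 ℤ.≤ n i
    n≥0 zero = ℤP.i≤j⇒0≤j-i (subst₂ ℤ._≤_
      (trans (ℤP.pos-+ (m * x) (m * y)) (cong₂ ℤ._+_ (ℤP.pos-* m x) (ℤP.pos-* m y)))
      (trans (ℤP.pos-+ (m * (t * s)) h) (cong (ℤ._+ H) D≡)) (ℤ.+≤+ mx+my≤mu+h))
    n≥0 (suc zero)             = ℤP.i≤j⇒0≤j-i (subst (H ℤ.≤_) (ℤP.pos-* m x) (ℤ.+≤+ h≤mx))
    n≥0 (suc (suc zero))       = ℤP.i≤j⇒0≤j-i (subst (H ℤ.≤_) (ℤP.pos-* m y) (ℤ.+≤+ h≤my))
    n≥0 (suc (suc (suc zero))) = ℤ.+≤+ z≤n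
    sum≡ : ∀ M T S H X Y →
      M ℤ.* (T ℤ.* S) ℤ.+ H ℤ.- (M ℤ.* X ℤ.+ M ℤ.* Y) ℤ.+ ((M ℤ.* X ℤ.- H) ℤ.+ ((M ℤ.* Y ℤ.- H) ℤ.+ (H ℤ.+ + 0))) ≡
      M ℤ.* (T ℤ.* S)
    sum≡ = ℤSolver.solve-∀
    coord₀ : ∀ M T S H X Y →
      (M ℤ.* (T ℤ.* S) ℤ.+ H ℤ.- (M ℤ.* X ℤ.+ M ℤ.* Y)) ℤ.* (T ℤ.* + 0) ℤ.+ ((M ℤ.* X ℤ.- H) ℤ.* (T ℤ.* S) ℤ.+
      ((M ℤ.* Y ℤ.- H) ℤ.* (T ℤ.* + 0) ℤ.+ (H ℤ.* (T ℤ.* S) ℤ.+ + 0))) ≡ M ℤ.* (T ℤ.* S) ℤ.* X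
    coord₀ = ℤSolver.solve-∀
    coord₁ : ∀ M T S H X Y →
      (M ℤ.* (T ℤ.* S) ℤ.+ H ℤ.- (M ℤ.* X ℤ.+ M ℤ.* Y)) ℤ.* (T ℤ.* + 0) ℤ.+ ((M ℤ.* X ℤ.- H) ℤ.* (T ℤ.* + 0) ℤ.+
      ((M ℤ.* Y ℤ.- H) ℤ.* (T ℤ.* S) ℤ.+ (H ℤ.* (T ℤ.* S) ℤ.+ + 0))) ≡ M ℤ.* (T ℤ.* S) ℤ.* Y
    coord₁ = ℤSolver.solve-∀
    coord₂ : ∀ M T S H X Y →
      (M ℤ.* (T ℤ.* S) ℤ.+ H ℤ.- (M ℤ.* X ℤ.+ M ℤ.* Y)) ℤ.* (T ℤ.* + 0) ℤ.+ ((M ℤ.* X ℤ.- H) ℤ.* (T ℤ.* + 0) ℤ.+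
      ((M ℤ.* Y ℤ.- H) ℤ.* (T ℤ.* + 0) ℤ.+ (H ℤ.* (T ℤ.* (S ℤ.* M)) ℤ.+ + 0))) ≡ M ℤ.* (T ℤ.* S) ℤ.* H
    coord₂ = ℤSolver.solve-∀

  InDilate-reeve : ∀ z → (∃ λ p → ReevePoint m (t * s) p × z ≡ toPoint p) ⇔ InDilate (reeve s m) t z
  InDilate-reeve z = mk⇔ (λ { (p , p∈ , refl) → InDilate-reeve⁺ p p∈ }) (from z)
    where
    natural : ∀ x y h → ReeveFacets x y h → ∃ λ p → ReevePoint m (t * s) p × (x ∷ y ∷ h ∷ []) ≡ toPoint p
    natural (+ x) (+ y) (+ h) (_ , h≤mx , h≤my , mx+my≤mu+h) =
      (x , y , h) ,
      (ℤP.drop‿+≤+ (subst (+ h ℤ.≤_) (sym (ℤP.pos-* m x)) h≤mx) ,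
       ℤP.drop‿+≤+ (subst (+ h ℤ.≤_) (sym (ℤP.pos-* m y)) h≤my) ,
       ℤP.drop‿+≤+ (subst₂ ℤ._≤_
         (sym (trans (ℤP.pos-+ (m * x) (m * y)) (cong₂ ℤ._+_ (ℤP.pos-* m x) (ℤP.pos-* m y))))
         (sym (trans (ℤP.pos-+ (m * (t * s)) h) (cong (ℤ._+ + h) (ℤP.pos-* m (t * s))))) mx+my≤mu+h)) ,
      refl
    natural -[1+ x ] y h (0≤h , h≤mx , _) with 0≤m*x⇒0≤x m -[1+ x ] (ℤP.≤-trans 0≤h h≤mx)
    ... | ()
    natural (+ x) -[1+ y ] h (0≤h , _ , h≤my , _) with 0≤m*x⇒0≤x m -[1+ y ] (ℤP.≤-trans 0≤h h≤my)
    ... | ()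
    natural (+ x) (+ y) -[1+ h ] (() , _)
    from : ∀ z → InDilate (reeve s m) t z → ∃ λ p → ReevePoint m (t * s) p × z ≡ toPoint p
    from (x ∷ y ∷ h ∷ []) z∈ = natural x y h (InDilate-reeve⁻ x y h z∈)

AffIndep-reeve : ∀ s m → AffIndep (reeve (suc s) (suc m))
AffIndep-reeve s m c c-sum c-coord = λ where
    zero                   → c₀≡0
    (suc zero)             → c₁≡0
    (suc (suc zero))       → c₂≡0
    (suc (suc (suc zero))) → c₃≡0
  where
  c₀ c₁ c₂ c₃ S SM : ℚ
  c₀ = c zero
  c₁ = c (suc zero)
  c₂ = c (suc (suc zero))
  c₃ = c (suc (suc (suc zero)))
  S = ℕ→ℚ (suc s)
  SM = ℤ→ℚ (+ suc s ℤ.* + suc m)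

  e₀ : c₁ ℚ.* S ℚ.+ c₃ ℚ.* S ≡ 0ℚ
  e₀ = trans (sym (clean c₀ c₁ c₂ c₃ S)) (c-coord zero)
    where
    clean : ∀ c₀ c₁ c₂ c₃ S → c₀ ℚ.* 0ℚ ℚ.+ (c₁ ℚ.* S ℚ.+ (c₂ ℚ.* 0ℚ ℚ.+ (c₃ ℚ.* S ℚ.+ 0ℚ))) ≡ c₁ ℚ.* S ℚ.+ c₃ ℚ.* S
    clean = RingSolver.solve-∀ ℚ-ring
  e₁ : c₂ ℚ.* S ℚ.+ c₃ ℚ.* S ≡ 0ℚ
  e₁ = trans (sym (clean c₀ c₁ c₂ c₃ S)) (c-coord (suc zero))
    where
    clean : ∀ c₀ c₁ c₂ c₃ S → c₀ ℚ.* 0ℚ ℚ.+ (c₁ ℚ.* 0ℚ ℚ.+ (c₂ ℚ.* S ℚ.+ (c₃ ℚ.* S ℚ.+ 0ℚ))) ≡ c₂ ℚ.* S ℚ.+ c₃ ℚ.* S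
    clean = RingSolver.solve-∀ ℚ-ring
  e₂ : c₃ ℚ.* SM ≡ 0ℚ
  e₂ = trans (sym (clean c₀ c₁ c₂ c₃ SM)) (c-coord (suc (suc zero)))
    where
    clean : ∀ c₀ c₁ c₂ c₃ v → c₀ ℚ.* 0ℚ ℚ.+ (c₁ ℚ.* 0ℚ ℚ.+ (c₂ ℚ.* 0ℚ ℚ.+ (c₃ ℚ.* v ℚ.+ 0ℚ))) ≡ c₃ ℚ.* v
    clean = RingSolver.solve-∀ ℚ-ring

  c₃≡0 : c₃ ≡ 0ℚ
  c₃≡0 = p*[1+d]≡0⇒p≡0 c₃ (m + s * suc m)
    (trans (cong (λ v → c₃ ℚ.* ℤ→ℚ v) (ℤP.pos-* (suc s) (suc m))) e₂)
  c₃S≡0 : c₃ ℚ.* S ≡ 0ℚ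
  c₃S≡0 = trans (cong (ℚ._* S) c₃≡0) (ℚP.*-zeroˡ S)
  c₁≡0 : c₁ ≡ 0ℚ
  c₁≡0 = p*[1+d]≡0⇒p≡0 c₁ s (trans (sym (ℚP.+-identityʳ (c₁ ℚ.* S))) (trans (cong (c₁ ℚ.* S ℚ.+_) (sym c₃S≡0)) e₀))
  c₂≡0 : c₂ ≡ 0ℚ
  c₂≡0 = p*[1+d]≡0⇒p≡0 c₂ s (trans (sym (ℚP.+-identityʳ (c₂ ℚ.* S))) (trans (cong (c₂ ℚ.* S ℚ.+_) (sym c₃S≡0)) e₁))
  c₀≡0 : c₀ ≡ 0ℚ
  c₀≡0 = trans (sym (ℚP.+-identityʳ c₀))
    (trans (cong (c₀ ℚ.+_) (sym (cong₂ ℚ._+_ c₁≡0 (cong₂ ℚ._+_ c₂≡0 (cong (ℚ._+ 0ℚ) c₃≡0))))) c-sum)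

Triangle : ℕ → ℕ × ℕ → Set
Triangle v (x , y) = x + y ≤ v

triangle : ℕ → ℕ
triangle zero    = 1
triangle (suc v) = suc (suc v) + triangle v

HasSize-column : ∀ c → HasSize (λ ((x , y) : ℕ × ℕ) → x ≡ 0 × y < suc c) (suc c)
HasSize-column c = HasSize-resp-⇔
  (λ _ → mk⇔ (λ { (y , y<1+c , refl) → refl , y<1+c }) (λ { (refl , y<1+c) → _ , y<1+c , refl }))
  (HasSize-image (0 ,_) (λ { refl → refl }) (HasSize-< (suc c)))

HasSize-triangle : ∀ v → HasSize (Triangle v) (triangle v)
HasSize-triangle zero = HasSize-resp-⇔ (λ z → mk⇔ to (from z)) (HasSize-column 0)
  where
  to : ∀ {z} → proj₁ z ≡ 0 × proj₂ z < 1 → Triangle 0 z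
  to (refl , s≤s y≤0) = y≤0
  from : ∀ z → Triangle 0 z → proj₁ z ≡ 0 × proj₂ z < 1
  from (zero , zero) _ = refl , s≤s z≤n
HasSize-triangle (suc v) =
  HasSize-resp-⇔ (λ z → mk⇔ to (from z))
    (HasSize-⊎ disjoint (HasSize-column (suc v)) (HasSize-image sucˣ sucˣ-injective (HasSize-triangle v)))
  where
  sucˣ : ℕ × ℕ → ℕ × ℕ
  sucˣ (x , y) = suc x , y
  sucˣ-injective : ∀ {p q} → sucˣ p ≡ sucˣ q → p ≡ q
  sucˣ-injective {x , y} {.x , .y} refl = refl
  Column Shifted : ℕ × ℕ → Set
  Column (x , y) = x ≡ 0 × y < suc (suc v)
  Shifted z = ∃ λ q → Triangle v q × z ≡ sucˣ q
  disjoint : ∀ z → Column z → Shifted z → ⊥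
  disjoint _ (refl , _) (_ , _ , ())
  to : ∀ {z} → Column z ⊎ Shifted z → Triangle (suc v) z
  to (inj₁ (refl , s≤s y≤1+v)) = y≤1+v
  to (inj₂ ((x , y) , x+y≤v , refl)) = s≤s x+y≤v
  from : ∀ z → Triangle (suc v) z → Column z ⊎ Shifted z
  from (zero  , y) y≤1+v         = inj₁ (refl , s≤s y≤1+v)
  from (suc x , y) (s≤s x+y≤v)   = inj₂ ((x , y) , x+y≤v , refl)

InnerTriangle : ℕ → ℕ × ℕ → Set
InnerTriangle v (x , y) = 1 ≤ x × 1 ≤ y × x + y ≤ v

innerTriangle : ℕ → ℕ
innerTriangle (suc (suc v)) = triangle v
innerTriangle _             = 0

HasSize-innerTriangle : ∀ v → HasSize (InnerTriangle v) (innerTriangle v)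
HasSize-innerTriangle zero          = HasSize-∅ λ { (suc x , suc y) (_ , _ , ()) }
HasSize-innerTriangle (suc zero)    = HasSize-∅ λ where
  (suc x , suc y) (_ , _ , s≤s x+1+y≤0) → ℕP.n≮0 (subst (_≤ 0) (ℕP.+-suc x y) x+1+y≤0)
HasSize-innerTriangle (suc (suc v)) =
  HasSize-resp-⇔ (λ z → mk⇔ to (from z)) (HasSize-image suc² suc²-injective (HasSize-triangle v))
  where
  suc² : ℕ × ℕ → ℕ × ℕ
  suc² (x , y) = suc x , suc y
  suc²-injective : ∀ {p q} → suc² p ≡ suc² q → p ≡ q
  suc²-injective {x , y} {.x , .y} refl = refl
  to : ∀ {z} → (∃ λ q → Triangle v q × z ≡ suc² q) → InnerTriangle (suc (suc v)) z
  to ((x , y) , x+y≤v , refl) = s≤s z≤n , s≤s z≤n , s≤s (subst (_≤ suc v) (sym (ℕP.+-suc x y)) (s≤s x+y≤v))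
  from : ∀ z → InnerTriangle (suc (suc v)) z → ∃ λ q → Triangle v q × z ≡ suc² q
  from (suc x , suc y) (_ , _ , s≤s x+1+y≤1+v) = (x , y) , ℕ.s≤s⁻¹ (subst (_≤ suc v) (ℕP.+-suc x y) x+1+y≤1+v) , refl

module _ (m′ : ℕ) where

  private
    m = suc m′

  layerSize : ℕ → ℕ
  layerSize u = triangle u + m′ * innerTriangle u

  reeveSize : ℕ → ℕ
  reeveSize zero    = layerSize zero
  reeveSize (suc u) = reeveSize u + layerSize (suc u)

  shiftUp : ℕ × ℕ × ℕ → ℕ × ℕ × ℕ
  shiftUp (x , y , h) = suc x , suc y , m + h

  shiftUp-injective : ∀ {p q} → shiftUp p ≡ shiftUp q → p ≡ q
  shiftUp-injective {x , y , h} {x′ , y′ , h′} eq =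
    cong₂ _,_ (ℕP.suc-injective (cong proj₁ eq))
      (cong₂ _,_ (ℕP.suc-injective (cong (proj₁ ∘ proj₂) eq)) (ℕP.+-cancelˡ-≡ m h h′ (cong (proj₂ ∘ proj₂) eq)))

  ReevePoint-shiftUp : ∀ u p → ReevePoint m u p ⇔ ReevePoint m (suc u) (shiftUp p)
  ReevePoint-shiftUp u (x , y , h) = mk⇔
    (λ (h≤mx , h≤my , base) → sucʳ x h≤mx , sucʳ y h≤my ,
       subst₂ _≤_ (sym (sum≡ m x y)) (sym (sum≡′ m u h)) (ℕP.+-monoʳ-≤ m (ℕP.+-monoʳ-≤ m base)))
    (λ (h≤mx , h≤my , base) → sucˡ x h≤mx , sucˡ y h≤my ,
       ℕP.+-cancelˡ-≤ m _ _ (ℕP.+-cancelˡ-≤ m _ _ (subst₂ _≤_ (sum≡ m x y) (sum≡′ m u h) base)))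
    where
    sucʳ : ∀ x → h ≤ m * x → m + h ≤ m * suc x
    sucʳ x h≤mx = subst (m + h ≤_) (sym (ℕP.*-suc m x)) (ℕP.+-monoʳ-≤ m h≤mx)
    sucˡ : ∀ x → m + h ≤ m * suc x → h ≤ m * x
    sucˡ x le = ℕP.+-cancelˡ-≤ m h (m * x) (subst (m + h ≤_) (ℕP.*-suc m x) le)
    sum≡ : ∀ m x y → m * suc x + m * suc y ≡ m + (m + (m * x + m * y))
    sum≡ = ℕSolver.solve-∀
    sum≡′ : ∀ m u h → m * suc u + (m + h) ≡ m + (m + (m * u + h))
    sum≡′ = ℕSolver.solve-∀

  private
    Floor Middle : ℕ → ℕ × ℕ × ℕ → Set
    Floor u (x , y , h) = h ≡ 0 × Triangle u (x , y)
    Middle u (x , y , h) = (1 ≤ h × h ≤ m′) × InnerTriangle u (x , y)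

    ≤m*0⇒≡0 : ∀ {h} → h ≤ m * 0 → h ≡ 0
    ≤m*0⇒≡0 {h} h≤0 = ℕP.n≤0⇒n≡0 (subst (h ≤_) (ℕP.*-zeroʳ m) h≤0)

    m*x+m*y≡m*[x+y] : ∀ x y → m * x + m * y ≡ m * (x + y)
    m*x+m*y≡m*[x+y] x y = sym (ℕP.*-distribˡ-+ m x y)

    lowTo : ∀ u p → Floor u p ⊎ Middle u p → ReevePoint m u p
    lowTo u (x , y , h) (inj₁ (refl , x+y≤u)) = z≤n , z≤n ,
      subst₂ _≤_ (sym (m*x+m*y≡m*[x+y] x y)) (sym (ℕP.+-identityʳ (m * u))) (ℕP.*-monoʳ-≤ m x+y≤u)
    lowTo u (x , y , h) (inj₂ ((_ , h≤m′) , 1≤x , 1≤y , x+y≤u)) =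
      ℕP.≤-trans (ℕP.m≤n⇒m≤1+n h≤m′) (ℕP.m≤m*n m x {{ℕ.>-nonZero 1≤x}}) ,
      ℕP.≤-trans (ℕP.m≤n⇒m≤1+n h≤m′) (ℕP.m≤m*n m y {{ℕ.>-nonZero 1≤y}}) ,
      ℕP.≤-trans (subst (_≤ m * u) (sym (m*x+m*y≡m*[x+y] x y)) (ℕP.*-monoʳ-≤ m x+y≤u)) (ℕP.m≤m+n (m * u) h)

    lowFrom : ∀ u p → proj₂ (proj₂ p) < m → ReevePoint m u p → Floor u p ⊎ Middle u p
    lowFrom u (x , y , zero) _ (_ , _ , base) =
      inj₁ (refl , ℕP.*-cancelˡ-≤ m (subst₂ _≤_ (m*x+m*y≡m*[x+y] x y) (ℕP.+-identityʳ (m * u)) base))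
    lowFrom u (zero , y , suc h) _ (h≤0 , _ , _) with ≤m*0⇒≡0 h≤0
    ... | ()
    lowFrom u (suc x , zero , suc h) _ (_ , h≤0 , _) with ≤m*0⇒≡0 h≤0
    ... | ()
    lowFrom u (suc x , suc y , suc h) (s≤s h<m′) (_ , _ , base) =
      inj₂ ((s≤s z≤n , h<m′) , s≤s z≤n , s≤s z≤n , ℕ.s≤s⁻¹ (ℕP.*-cancelˡ-< m _ _ (begin-strict
        m * (suc x + suc y)   ≡⟨ m*x+m*y≡m*[x+y] (suc x) (suc y) ⟨
        m * suc x + m * suc y ≤⟨ base ⟩
        m * u + suc h         <⟨ ℕP.+-monoʳ-< (m * u) (s≤s h<m′) ⟩
        m * u + m             ≡⟨ ℕP.+-comm (m * u) m ⟩
        m + m * u             ≡⟨ ℕP.*-suc m u ⟨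
        m * suc u             ∎)))
      where open ℕP.≤-Reasoning

    HasSize-floor : ∀ u → HasSize (Floor u) (triangle u)
    HasSize-floor u = HasSize-resp-⇔
      (λ _ → mk⇔ (λ { (_ , x+y≤u , refl) → refl , x+y≤u }) (λ { (refl , x+y≤u) → _ , x+y≤u , refl }))
      (HasSize-image (λ (x , y) → x , y , 0) (λ { refl → refl }) (HasSize-triangle u))

    HasSize-middle : ∀ u → HasSize (Middle u) (m′ * innerTriangle u)
    HasSize-middle u = HasSize-resp-⇔
      (λ _ → mk⇔ (λ { (_ , (h∈ , q∈) , refl) → h∈ , q∈ }) (λ { (h∈ , q∈) → _ , (h∈ , q∈) , refl }))
      (HasSize-image (λ (h , x , y) → x , y , h) (λ { refl → refl })
        (HasSize-× (HasSize-resp-⇔ (λ _ → mk⇔ (λ { (h , h<m′ , refl) → s≤s z≤n , h<m′ })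
                                             (λ { (s≤s _ , h<m′) → _ , h<m′ , refl }))
                     (HasSize-image suc ℕP.suc-injective (HasSize-< m′)))
                   (HasSize-innerTriangle u)))

    Low High : ℕ → ℕ × ℕ × ℕ → Set
    Low u p = proj₂ (proj₂ p) < m × ReevePoint m u p
    High u p = m ≤ proj₂ (proj₂ p) × ReevePoint m u p

    HasSize-low : ∀ u → HasSize (Low u) (layerSize u)
    HasSize-low u = HasSize-resp-⇔
      (λ p → mk⇔ (λ fm → h<m p fm , lowTo u p fm) (λ (h<m , p∈) → lowFrom u p h<m p∈))
      (HasSize-⊎ disjoint (HasSize-floor u) (HasSize-middle u))
      where
      disjoint : ∀ p → Floor u p → Middle u p → ⊥
      disjoint _ (refl , _) ((() , _) , _)
      h<m : ∀ p → Floor u p ⊎ Middle u p → proj₂ (proj₂ p) < m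
      h<m _ (inj₁ (refl , _))        = s≤s z≤n
      h<m _ (inj₂ ((_ , h≤m′) , _)) = s≤s h≤m′

    HasSize-fromHigh : ∀ u {a} → HasSize (High u) a → HasSize (ReevePoint m u) (a + layerSize u)
    HasSize-fromHigh u high = HasSize-resp-⇔ (λ p → mk⇔ (λ { (inj₁ (_ , p∈)) → p∈ ; (inj₂ (_ , p∈)) → p∈ }) (split p))
      (HasSize-⊎ (λ _ (m≤h , _) (h<m , _) → ℕP.<⇒≱ h<m m≤h) high (HasSize-low u))
      where
      split : ∀ p → ReevePoint m u p → High u p ⊎ Low u p
      split p p∈ with m ℕP.≤? proj₂ (proj₂ p)
      ... | yes m≤h = inj₁ (m≤h , p∈)
      ... | no  m≰h = inj₂ (ℕP.≰⇒> m≰h , p∈)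

    ¬High-0 : ∀ p → ¬ High 0 p
    ¬High-0 (x , y , h) (m≤h , h≤mx , h≤my , base) = ℕP.<⇒≱ (ℕP.<-≤-trans (s≤s z≤n) m≤h) (begin
      h                      ≤⟨ h≤my ⟩
      m * y                  ≤⟨ ℕP.+-cancelˡ-≤ (m * x) (m * y) 0 (begin
        m * x + m * y          ≤⟨ base ⟩
        m * 0 + h              ≡⟨ cong (_+ h) (ℕP.*-zeroʳ m) ⟩
        h                      ≤⟨ h≤mx ⟩
        m * x                  ≡⟨ ℕP.+-identityʳ (m * x) ⟨
        m * x + 0              ∎) ⟩
      0                      ∎)
      where open ℕP.≤-Reasoning

    shifted⇔High : ∀ u p → (∃ λ q → ReevePoint m u q × p ≡ shiftUp q) ⇔ High (suc u) p
    shifted⇔High u p = mk⇔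
      (λ { ((x , y , h) , q∈ , refl) → ℕP.m≤m+n m h , Equivalence.to (ReevePoint-shiftUp u (x , y , h)) q∈ }) (from p)
      where
      from : ∀ p → High (suc u) p → ∃ λ q → ReevePoint m u q × p ≡ shiftUp q
      from (zero , y , h) (m≤h , h≤0 , _) with ≤m*0⇒≡0 (ℕP.≤-trans m≤h h≤0)
      ... | ()
      from (suc x , zero , h) (m≤h , _ , h≤0 , _) with ≤m*0⇒≡0 (ℕP.≤-trans m≤h h≤0)
      ... | ()
      from (suc x , suc y , h) (m≤h , p∈) =
        (x , y , h ∸ m) ,
        Equivalence.from (ReevePoint-shiftUp u (x , y , h ∸ m)) (subst (λ h → ReevePoint m (suc u) (suc x , suc y , h)) (sym h≡) p∈) ,
        cong (λ h → suc x , suc y , h) (sym h≡)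
        where
        h≡ : m + (h ∸ m) ≡ h
        h≡ = ℕP.m+[n∸m]≡n m≤h

  -- Points of height h ≥ m are the translates by (1, 1, m) of the points for u − 1 (there are none for
  -- u = 0); below height m lie the triangle at h = 0 and m − 1 copies of the inner triangle.
  HasSize-reeve : ∀ u → HasSize (ReevePoint m u) (reeveSize u)
  HasSize-reeve zero    = HasSize-fromHigh zero (HasSize-∅ ¬High-0)
  HasSize-reeve (suc u) = HasSize-fromHigh (suc u)
    (HasSize-resp-⇔ (shifted⇔High u) (HasSize-image shiftUp shiftUp-injective (HasSize-reeve u)))

2*triangle : ∀ v → 2 * triangle v ≡ (v + 1) * (v + 2)
2*triangle zero    = refl
2*triangle (suc v) = trans (ℕP.*-distribˡ-+ 2 (suc (suc v)) (triangle v))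
  (trans (cong (λ x → 2 * suc (suc v) + x) (2*triangle v)) (step v))
  where
  step : ∀ v → 2 * suc (suc v) + (v + 1) * (v + 2) ≡ (suc v + 1) * (suc v + 2)
  step = ℕSolver.solve-∀

2*innerTriangle : ∀ v → 2 * innerTriangle (suc v) ≡ v * (v + 1)
2*innerTriangle zero    = refl
2*innerTriangle (suc v) = trans (2*triangle v) (step v)
  where
  step : ∀ v → (v + 1) * (v + 2) ≡ suc v * (suc v + 1)
  step = ℕSolver.solve-∀

reeveSize-closed : ∀ μ′ u → let μ = suc μ′ in
  reeveSize (5 + 6 * μ′) u + μ * u ≡ μ * (u * u * u) + u * u + 2 * u + 1
reeveSize-closed μ′ zero = base μ′
  where
  base : ∀ μ′ → 1 + (5 + 6 * μ′) * 0 + suc μ′ * 0 ≡ suc μ′ * (0 * 0 * 0) + 0 * 0 + 2 * 0 + 1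
  base = ℕSolver.solve-∀
reeveSize-closed μ′ (suc u) = ℕP.*-cancelˡ-≡ _ _ 2 (begin
  2 * (R + (T + m′ * T₁) + μ * suc u)
    ≡⟨ regroup R T T₁ μ′ u ⟩
  2 * (R + μ * u) + 2 * T + m′ * (2 * T₁) + 2 * μ
    ≡⟨ cong₂ (λ a b → 2 * a + b + m′ * (2 * T₁) + 2 * μ) (reeveSize-closed μ′ u) (2*triangle (suc u)) ⟩
  2 * (μ * (u * u * u) + u * u + 2 * u + 1) + (suc u + 1) * (suc u + 2) + m′ * (2 * T₁) + 2 * μ
    ≡⟨ cong (λ a → 2 * (μ * (u * u * u) + u * u + 2 * u + 1) + (suc u + 1) * (suc u + 2) + m′ * a + 2 * μ) (2*innerTriangle u) ⟩
  2 * (μ * (u * u * u) + u * u + 2 * u + 1) + (suc u + 1) * (suc u + 2) + m′ * (u * (u + 1)) + 2 * μ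
    ≡⟨ expand μ′ u ⟩
  2 * (μ * (suc u * suc u * suc u) + suc u * suc u + 2 * suc u + 1) ∎)
  where
  open ≡-Reasoning
  μ m′ R T T₁ : ℕ
  μ = suc μ′
  m′ = 5 + 6 * μ′
  R = reeveSize m′ u
  T = triangle (suc u)
  T₁ = innerTriangle (suc u)
  regroup : ∀ R T T₁ μ′ u → 2 * (R + (T + (5 + 6 * μ′) * T₁) + suc μ′ * suc u) ≡
            2 * (R + suc μ′ * u) + 2 * T + (5 + 6 * μ′) * (2 * T₁) + 2 * suc μ′
  regroup = ℕSolver.solve-∀
  expand : ∀ μ′ u →
           2 * (suc μ′ * (u * u * u) + u * u + 2 * u + 1) + (suc u + 1) * (suc u + 2) + (5 + 6 * μ′) * (u * (u + 1)) + 2 * suc μ′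
           ≡ 2 * (suc μ′ * (suc u * suc u * suc u) + suc u * suc u + 2 * suc u + 1)
  expand = ℕSolver.solve-∀

LatticeCount-reeve : ∀ s m′ t .{{_ : ℕ.NonZero s}} .{{_ : ℕ.NonZero t}} →
                     LatticeCount (reeve s (suc m′)) t (reeveSize m′ (t * s))
LatticeCount-reeve s m′ t = HasSize-resp-⇔ {Q = InDilate (reeve s (suc m′)) t} (InDilate-reeve s (suc m′) t)
  (HasSize-image toPoint toPoint-injective (HasSize-reeve m′ (t * s)))

reeveSize-polynomial : ∀ μ′ u → let μ = suc μ′ in
  + reeveSize (5 + 6 * μ′) u ≡ + μ ℤ.* (+ u ℤ.* + u ℤ.* + u) ℤ.+ + u ℤ.* + u ℤ.+ (+ 2 ℤ.- + μ) ℤ.* + u ℤ.+ + 1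
reeveSize-polynomial μ′ u = begin
  + R                                       ≡⟨ cancel (+ R) (+ (μ * u)) ⟩
  + R ℤ.+ + (μ * u) ℤ.- + (μ * u)           ≡⟨⟩
  + (R + μ * u) ℤ.- + (μ * u)               ≡⟨ cong (λ x → + x ℤ.- + (μ * u)) (reeveSize-closed μ′ u) ⟩
  + (μ * (u * u * u) + u * u + 2 * u + 1) ℤ.- + (μ * u)
    ≡⟨ cong₂ ℤ._-_ (cast μ u) (ℤP.pos-* μ u) ⟩
  + μ ℤ.* (+ u ℤ.* + u ℤ.* + u) ℤ.+ + u ℤ.* + u ℤ.+ + 2 ℤ.* + u ℤ.+ + 1 ℤ.- + μ ℤ.* + u
    ≡⟨ regroup (+ μ) (+ u) ⟩
  + μ ℤ.* (+ u ℤ.* + u ℤ.* + u) ℤ.+ + u ℤ.* + u ℤ.+ (+ 2 ℤ.- + μ) ℤ.* + u ℤ.+ + 1 ∎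
  where
  open ≡-Reasoning
  μ R : ℕ
  μ = suc μ′
  R = reeveSize (5 + 6 * μ′) u
  cast : ∀ μ u → + (μ * (u * u * u) + u * u + 2 * u + 1) ≡ + μ ℤ.* (+ u ℤ.* + u ℤ.* + u) ℤ.+ + u ℤ.* + u ℤ.+ + 2 ℤ.* + u ℤ.+ + 1
  cast μ u = trans (cong₂ (λ p q → p ℤ.+ q ℤ.+ + (2 * u) ℤ.+ + 1)
                           (*-cast μ (u * u * u) refl (*-cast (u * u) u (ℤP.pos-* u u) refl)) (ℤP.pos-* u u))
                    (cong (λ p → + μ ℤ.* (+ u ℤ.* + u ℤ.* + u) ℤ.+ + u ℤ.* + u ℤ.+ p ℤ.+ + 1) (ℤP.pos-* 2 u))
  cancel : ∀ r x → r ≡ r ℤ.+ x ℤ.- x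
  cancel = ℤSolver.solve-∀
  regroup : ∀ μ u → μ ℤ.* (u ℤ.* u ℤ.* u) ℤ.+ u ℤ.* u ℤ.+ + 2 ℤ.* u ℤ.+ + 1 ℤ.- μ ℤ.* u ≡
                    μ ℤ.* (u ℤ.* u ℤ.* u) ℤ.+ u ℤ.* u ℤ.+ (+ 2 ℤ.- μ) ℤ.* u ℤ.+ + 1
  regroup = ℤSolver.solve-∀

-- Integer polynomials

evalℤ : ℕ → (ℕ → ℤ) → ℤ → ℤ
evalℤ zero    a x = a 0
evalℤ (suc d) a x = a (suc d) ℤ.* x ℤ.^ suc d ℤ.+ evalℤ d a x

ℤ→ℚ-homo-^ : ∀ x n → ℤ→ℚ x ^ℚ n ≡ ℤ→ℚ (x ℤ.^ n)
ℤ→ℚ-homo-^ x zero    = refl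
ℤ→ℚ-homo-^ x (suc n) = trans (cong (ℤ→ℚ x ℚ.*_) (ℤ→ℚ-homo-^ x n)) (sym (ℤ→ℚ-homo-* x (x ℤ.^ n)))

evalPoly-ℤ→ℚ : ∀ d (a : ℕ → ℤ) t → evalPoly d (ℤ→ℚ ∘ a) t ≡ ℤ→ℚ (evalℤ d a (+ t))
evalPoly-ℤ→ℚ zero    a t = refl
evalPoly-ℤ→ℚ (suc d) a t = begin
  ℤ→ℚ (a (suc d)) ℚ.* ℕ→ℚ t ^ℚ suc d ℚ.+ evalPoly d (ℤ→ℚ ∘ a) t
    ≡⟨ cong₂ (λ p q → ℤ→ℚ (a (suc d)) ℚ.* p ℚ.+ q) (ℤ→ℚ-homo-^ (+ t) (suc d)) (evalPoly-ℤ→ℚ d a t) ⟩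
  ℤ→ℚ (a (suc d)) ℚ.* ℤ→ℚ ((+ t) ℤ.^ suc d) ℚ.+ ℤ→ℚ (evalℤ d a (+ t))
    ≡⟨ cong (ℚ._+ ℤ→ℚ (evalℤ d a (+ t))) (ℤ→ℚ-homo-* (a (suc d)) ((+ t) ℤ.^ suc d)) ⟨
  ℤ→ℚ (a (suc d) ℤ.* (+ t) ℤ.^ suc d) ℚ.+ ℤ→ℚ (evalℤ d a (+ t))
    ≡⟨ ℤ→ℚ-homo-+ (a (suc d) ℤ.* (+ t) ℤ.^ suc d) (evalℤ d a (+ t)) ⟨
  ℤ→ℚ (evalℤ (suc d) a (+ t)) ∎
  where open ≡-Reasoning

mulX : (ℕ → ℤ) → ℕ → ℤ
mulX a zero    = + 0
mulX a (suc j) = a j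

evalℤ-extend : ∀ d a x → a (suc d) ≡ + 0 → evalℤ (suc d) a x ≡ evalℤ d a x
evalℤ-extend d a x a[1+d]≡0 = trans (cong (λ c → c ℤ.* x ℤ.^ suc d ℤ.+ evalℤ d a x) a[1+d]≡0)
  (trans (cong (ℤ._+ evalℤ d a x) (ℤP.*-zeroˡ (x ℤ.^ suc d))) (ℤP.+-identityˡ (evalℤ d a x)))

evalℤ-mulX : ∀ d a x → evalℤ (suc d) (mulX a) x ≡ x ℤ.* evalℤ d a x
evalℤ-mulX zero    a x = step (a 0) x
  where
  step : ∀ a x → a ℤ.* (x ℤ.* + 1) ℤ.+ + 0 ≡ x ℤ.* a
  step = ℤSolver.solve-∀
evalℤ-mulX (suc d) a x = trans (cong (λ e → a (suc d) ℤ.* x ℤ.^ suc (suc d) ℤ.+ e) (evalℤ-mulX d a x))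
  (step (a (suc d)) x (x ℤ.^ d) (evalℤ d a x))
  where
  step : ∀ a x p e → a ℤ.* (x ℤ.* (x ℤ.* p)) ℤ.+ x ℤ.* e ≡ x ℤ.* (a ℤ.* (x ℤ.* p) ℤ.+ e)
  step = ℤSolver.solve-∀

evalℤ-+ : ∀ d a b x → evalℤ d (λ j → a j ℤ.+ b j) x ≡ evalℤ d a x ℤ.+ evalℤ d b x
evalℤ-+ zero    a b x = refl
evalℤ-+ (suc d) a b x = trans (cong (λ e → (a (suc d) ℤ.+ b (suc d)) ℤ.* x ℤ.^ suc d ℤ.+ e) (evalℤ-+ d a b x))
  (step (a (suc d)) (b (suc d)) (x ℤ.^ suc d) (evalℤ d a x) (evalℤ d b x))
  where
  step : ∀ a b p e f → (a ℤ.+ b) ℤ.* p ℤ.+ (e ℤ.+ f) ≡ (a ℤ.* p ℤ.+ e) ℤ.+ (b ℤ.* p ℤ.+ f)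
  step = ℤSolver.solve-∀

evalℤ-* : ∀ d c a x → evalℤ d (λ j → c ℤ.* a j) x ≡ c ℤ.* evalℤ d a x
evalℤ-* zero    c a x = refl
evalℤ-* (suc d) c a x = trans (cong (λ e → c ℤ.* a (suc d) ℤ.* x ℤ.^ suc d ℤ.+ e) (evalℤ-* d c a x))
  (step c (a (suc d)) (x ℤ.^ suc d) (evalℤ d a x))
  where
  step : ∀ c a p e → c ℤ.* a ℤ.* p ℤ.+ c ℤ.* e ≡ c ℤ.* (a ℤ.* p ℤ.+ e)
  step = ℤSolver.solve-∀

evalℤ-cong : ∀ d {a b} x → (∀ j → a j ≡ b j) → evalℤ d a x ≡ evalℤ d b x
evalℤ-cong zero    x a≗b = a≗b 0
evalℤ-cong (suc d) x a≗b = cong₂ (λ c e → c ℤ.* x ℤ.^ suc d ℤ.+ e) (a≗b (suc d)) (evalℤ-cong d x a≗b)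

evalℤ-extend⁺ : ∀ k d a x → (∀ j → d < j → a j ≡ + 0) → evalℤ (k + d) a x ≡ evalℤ d a x
evalℤ-extend⁺ zero    d a x _        = refl
evalℤ-extend⁺ (suc k) d a x vanishes =
  trans (evalℤ-extend (k + d) a x (vanishes _ (s≤s (ℕP.m≤n+m d k)))) (evalℤ-extend⁺ k d a x vanishes)

mulCubic : ℤ → ℤ → ℤ → (ℕ → ℤ) → ℕ → ℤ
mulCubic q₁ q₂ q₃ a j = a j ℤ.+ q₁ ℤ.* mulX a j ℤ.+ q₂ ℤ.* mulX (mulX a) j ℤ.+ q₃ ℤ.* mulX (mulX (mulX a)) j

module _ (q₁ q₂ q₃ : ℤ) (d : ℕ) (a : ℕ → ℤ) (vanishes : ∀ j → d < j → a j ≡ + 0) where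

  mulCubic-vanishes : ∀ j → 3 + d < j → mulCubic q₁ q₂ q₃ a j ≡ + 0
  mulCubic-vanishes (suc (suc (suc k))) (s≤s (s≤s (s≤s d<k))) = begin
    a (3 + k) ℤ.+ q₁ ℤ.* a (2 + k) ℤ.+ q₂ ℤ.* a (1 + k) ℤ.+ q₃ ℤ.* a k
      ≡⟨ cong₂ ℤ._+_ (cong₂ ℤ._+_ (cong₂ (λ u v → u ℤ.+ q₁ ℤ.* v) (vanishes _ (ℕP.m<n⇒m<1+n (ℕP.m<n⇒m<1+n (ℕP.m<n⇒m<1+n d<k))))
                                                                  (vanishes _ (ℕP.m<n⇒m<1+n (ℕP.m<n⇒m<1+n d<k))))
                                   (cong (q₂ ℤ.*_) (vanishes _ (ℕP.m<n⇒m<1+n d<k))))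
                     (cong (q₃ ℤ.*_) (vanishes k d<k)) ⟩
    + 0 ℤ.+ q₁ ℤ.* + 0 ℤ.+ q₂ ℤ.* + 0 ℤ.+ q₃ ℤ.* + 0
      ≡⟨ zeros q₁ q₂ q₃ ⟩
    + 0 ∎
    where
    open ≡-Reasoning
    zeros : ∀ q₁ q₂ q₃ → + 0 ℤ.+ q₁ ℤ.* + 0 ℤ.+ q₂ ℤ.* + 0 ℤ.+ q₃ ℤ.* + 0 ≡ + 0
    zeros = ℤSolver.solve-∀

  evalℤ-mulCubic : ∀ x → evalℤ (3 + d) (mulCubic q₁ q₂ q₃ a) x ≡
                   (+ 1 ℤ.+ q₁ ℤ.* x ℤ.+ q₂ ℤ.* (x ℤ.* x) ℤ.+ q₃ ℤ.* (x ℤ.* x ℤ.* x)) ℤ.* evalℤ d a x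
  evalℤ-mulCubic x = begin
    evalℤ D (mulCubic q₁ q₂ q₃ a) x
      ≡⟨ trans (evalℤ-+ D (λ j → a j ℤ.+ q₁ ℤ.* a₁ j ℤ.+ q₂ ℤ.* a₂ j) (λ j → q₃ ℤ.* a₃ j) x)
          (cong₂ ℤ._+_ (trans (evalℤ-+ D (λ j → a j ℤ.+ q₁ ℤ.* a₁ j) (λ j → q₂ ℤ.* a₂ j) x)
                              (cong₂ ℤ._+_ (evalℤ-+ D a (λ j → q₁ ℤ.* a₁ j) x) (evalℤ-* D q₂ a₂ x)))
                       (evalℤ-* D q₃ a₃ x)) ⟩
    evalℤ D a x ℤ.+ evalℤ D (λ j → q₁ ℤ.* a₁ j) x ℤ.+ q₂ ℤ.* evalℤ D a₂ x ℤ.+ q₃ ℤ.* evalℤ D a₃ x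
      ≡⟨ cong₂ ℤ._+_ (cong₂ ℤ._+_ (cong₂ ℤ._+_ (evalℤ-extend⁺ 3 d a x vanishes) (trans (evalℤ-* D q₁ a₁ x) (cong (q₁ ℤ.*_) e₁)))
                                   (cong (q₂ ℤ.*_) e₂))
                     (cong (q₃ ℤ.*_) e₃) ⟩
    P ℤ.+ q₁ ℤ.* (x ℤ.* P) ℤ.+ q₂ ℤ.* (x ℤ.* (x ℤ.* P)) ℤ.+ q₃ ℤ.* (x ℤ.* (x ℤ.* (x ℤ.* P)))
      ≡⟨ factor P q₁ q₂ q₃ x ⟩
    (+ 1 ℤ.+ q₁ ℤ.* x ℤ.+ q₂ ℤ.* (x ℤ.* x) ℤ.+ q₃ ℤ.* (x ℤ.* x ℤ.* x)) ℤ.* P ∎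
    where
    open ≡-Reasoning
    D : ℕ
    D = 3 + d
    P : ℤ
    P = evalℤ d a x
    a₁ a₂ a₃ : ℕ → ℤ
    a₁ = mulX a
    a₂ = mulX a₁
    a₃ = mulX a₂
    e₁ : evalℤ D (mulX a) x ≡ x ℤ.* P
    e₁ = trans (evalℤ-mulX (2 + d) a x) (cong (x ℤ.*_) (evalℤ-extend⁺ 2 d a x vanishes))
    e₂ : evalℤ D (mulX (mulX a)) x ≡ x ℤ.* (x ℤ.* P)
    e₂ = trans (evalℤ-mulX (2 + d) (mulX a) x)
      (cong (x ℤ.*_) (trans (evalℤ-mulX (1 + d) a x) (cong (x ℤ.*_) (evalℤ-extend⁺ 1 d a x vanishes))))
    e₃ : evalℤ D (mulX (mulX (mulX a))) x ≡ x ℤ.* (x ℤ.* (x ℤ.* P))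
    e₃ = trans (evalℤ-mulX (2 + d) (mulX (mulX a)) x)
      (cong (x ℤ.*_) (trans (evalℤ-mulX (1 + d) (mulX a) x) (cong (x ℤ.*_) (evalℤ-mulX d a x))))
    factor : ∀ P q₁ q₂ q₃ x → P ℤ.+ q₁ ℤ.* (x ℤ.* P) ℤ.+ q₂ ℤ.* (x ℤ.* (x ℤ.* P)) ℤ.+ q₃ ℤ.* (x ℤ.* (x ℤ.* (x ℤ.* P))) ≡
                              (+ 1 ℤ.+ q₁ ℤ.* x ℤ.+ q₂ ℤ.* (x ℤ.* x) ℤ.+ q₃ ℤ.* (x ℤ.* x ℤ.* x)) ℤ.* P
    factor = ℤSolver.solve-∀

binomialCoeff : ℕ → ℕ → ℕ → ℕ
binomialCoeff L N j = (N C j) * L ^ j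

binomialCoeff-vanishes : ∀ L N j → N < j → + binomialCoeff L N j ≡ + 0
binomialCoeff-vanishes L N j N<j = cong (λ c → + (c * L ^ j)) (k>n⇒nCk≡0 N<j)

binomialCoeff-suc : ∀ L N j → + binomialCoeff L (suc N) j ≡ + binomialCoeff L N j ℤ.+ + L ℤ.* mulX (λ i → + binomialCoeff L N i) j
binomialCoeff-suc L N zero    = sym (cong (λ v → + 1 ℤ.+ v) (ℤP.*-zeroʳ (+ L)))
binomialCoeff-suc L N (suc j) = begin
  + ((suc N C suc j) * L ^ suc j)
    ≡⟨ cong (λ c → + (c * L ^ suc j)) (nCk+nC[k+1]≡[n+1]C[k+1] N j) ⟨
  + ((N C j + N C suc j) * (L * L ^ j))
    ≡⟨ cong +_ (pascal (N C j) (N C suc j) L (L ^ j)) ⟩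
  + ((N C suc j) * L ^ suc j + L * ((N C j) * L ^ j))
    ≡⟨ trans (ℤP.pos-+ (binomialCoeff L N (suc j)) (L * binomialCoeff L N j))
         (cong (λ v → + binomialCoeff L N (suc j) ℤ.+ v) (ℤP.pos-* L (binomialCoeff L N j))) ⟩
  + binomialCoeff L N (suc j) ℤ.+ + L ℤ.* + binomialCoeff L N j ∎
  where
  open ≡-Reasoning
  pascal : ∀ a b L p → (a + b) * (L * p) ≡ b * (L * p) + L * (a * p)
  pascal = ℕSolver.solve-∀

evalℤ-binomial : ∀ L N x → evalℤ N (λ j → + binomialCoeff L N j) x ≡ (+ 1 ℤ.+ + L ℤ.* x) ℤ.^ N
evalℤ-binomial L zero    x = refl
evalℤ-binomial L (suc N) x = begin
  evalℤ (suc N) (λ j → + binomialCoeff L (suc N) j) x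
    ≡⟨ evalℤ-cong (suc N) x (binomialCoeff-suc L N) ⟩
  evalℤ (suc N) (λ j → B j ℤ.+ + L ℤ.* mulX B j) x
    ≡⟨ trans (evalℤ-+ (suc N) B (λ j → + L ℤ.* mulX B j) x)
             (cong (λ v → evalℤ (suc N) B x ℤ.+ v) (evalℤ-* (suc N) (+ L) (mulX B) x)) ⟩
  evalℤ (suc N) B x ℤ.+ + L ℤ.* evalℤ (suc N) (mulX B) x
    ≡⟨ cong₂ (λ u v → u ℤ.+ + L ℤ.* v) (evalℤ-extend N B x (binomialCoeff-vanishes L N (suc N) ℕP.≤-refl)) (evalℤ-mulX N B x) ⟩
  evalℤ N B x ℤ.+ + L ℤ.* (x ℤ.* evalℤ N B x)
    ≡⟨ cong (λ P → P ℤ.+ + L ℤ.* (x ℤ.* P)) (evalℤ-binomial L N x) ⟩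
  P ℤ.+ + L ℤ.* (x ℤ.* P)
    ≡⟨ factor P (+ L) x ⟩
  (+ 1 ℤ.+ + L ℤ.* x) ℤ.* P ∎
  where
  open ≡-Reasoning
  B = λ j → + binomialCoeff L N j
  P = (+ 1 ℤ.+ + L ℤ.* x) ℤ.^ N
  factor : ∀ P L x → P ℤ.+ L ℤ.* (x ℤ.* P) ≡ (+ 1 ℤ.+ L ℤ.* x) ℤ.* P
  factor = ℤSolver.solve-∀

-- Binomial coefficients

C-absorb : ∀ n k → suc k * (n C suc k) ≡ (n ∸ k) * (n C k)
C-absorb zero    k       = trans (ℕP.*-zeroʳ (suc k)) (cong (_* (0 C k)) (sym (ℕP.0∸n≡0 k)))
C-absorb (suc n) zero    = trans (ℕP.+-identityʳ (suc n C 1)) (trans (nC1≡n (suc n)) (sym (ℕP.*-identityʳ (suc n))))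
C-absorb (suc n) (suc k) = begin
  suc (suc k) * (suc n C suc (suc k))             ≡⟨ cong (suc (suc k) *_) (nCk+nC[k+1]≡[n+1]C[k+1] n (suc k)) ⟨
  suc (suc k) * (C₁ + C₂)                         ≡⟨ ℕP.*-distribˡ-+ (suc (suc k)) C₁ C₂ ⟩
  suc (suc k) * C₁ + suc (suc k) * C₂             ≡⟨ cong (λ x → suc (suc k) * C₁ + x) (C-absorb n (suc k)) ⟩
  suc (suc k) * C₁ + (n ∸ suc k) * C₁             ≡⟨ ℕP.*-distribʳ-+ C₁ (suc (suc k)) (n ∸ suc k) ⟨
  (suc (suc k) + (n ∸ suc k)) * C₁                ≡⟨ shift ⟩
  (suc k + (n ∸ k)) * C₁                          ≡⟨ ℕP.*-distribʳ-+ C₁ (suc k) (n ∸ k) ⟩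
  suc k * C₁ + (n ∸ k) * C₁                       ≡⟨ cong (_+ (n ∸ k) * C₁) (C-absorb n k) ⟩
  (n ∸ k) * C₀ + (n ∸ k) * C₁                     ≡⟨ ℕP.*-distribˡ-+ (n ∸ k) C₀ C₁ ⟨
  (n ∸ k) * (C₀ + C₁)                             ≡⟨ cong ((n ∸ k) *_) (nCk+nC[k+1]≡[n+1]C[k+1] n k) ⟩
  (n ∸ k) * (suc n C suc k)                       ∎
  where
  open ≡-Reasoning
  C₀ C₁ C₂ : ℕ
  C₀ = n C k
  C₁ = n C suc k
  C₂ = n C suc (suc k)
  shift : (suc (suc k) + (n ∸ suc k)) * C₁ ≡ (suc k + (n ∸ k)) * C₁
  shift with k ℕP.<? n
  ... | yes k<n = cong (_* C₁) (trans (sym (ℕP.+-suc (suc k) (n ∸ suc k))) (cong (λ x → suc k + x) (sym (ℕP.+-∸-assoc 1 k<n))))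
  ... | no  k≮n = begin
    (suc (suc k) + (n ∸ suc k)) * C₁   ≡⟨ cong ((suc (suc k) + (n ∸ suc k)) *_) C₁≡0 ⟩
    (suc (suc k) + (n ∸ suc k)) * 0    ≡⟨ ℕP.*-zeroʳ (suc (suc k) + (n ∸ suc k)) ⟩
    0                                  ≡⟨ ℕP.*-zeroʳ (suc k + (n ∸ k)) ⟨
    (suc k + (n ∸ k)) * 0              ≡⟨ cong ((suc k + (n ∸ k)) *_) C₁≡0 ⟨
    (suc k + (n ∸ k)) * C₁             ∎
    where
    C₁≡0 : C₁ ≡ 0
    C₁≡0 = k>n⇒nCk≡0 (s≤s (ℕP.≮⇒≥ k≮n))

C-pos : ∀ n k → k ≤ n → 0 < n C k
C-pos n       zero    _         = s≤s z≤n
C-pos (suc n) (suc k) (s≤s k≤n) =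
  subst (0 <_) (nCk+nC[k+1]≡[n+1]C[k+1] n k) (ℕP.<-≤-trans (C-pos n k k≤n) (ℕP.m≤m+n (n C k) (n C suc k)))

C-bound : ∀ L N i → (N C i) * L ^ i ≤ suc L ^ N
C-bound L zero    zero    = ℕP.≤-refl
C-bound L zero    (suc i) = z≤n
C-bound L (suc N) zero    = subst (_≤ suc L ^ suc N) (sym (ℕP.+-identityʳ 1)) (ℕP.m^n>0 (suc L) (suc N))
C-bound L (suc N) (suc i) = begin
  (suc N C suc i) * L ^ suc i                          ≡⟨ cong (_* L ^ suc i) (nCk+nC[k+1]≡[n+1]C[k+1] N i) ⟨
  ((N C i) + (N C suc i)) * (L * L ^ i)                ≡⟨ split (N C i) (N C suc i) L (L ^ i) ⟩
  L * ((N C i) * L ^ i) + (N C suc i) * L ^ suc i      ≤⟨ ℕP.+-mono-≤ (ℕP.*-monoʳ-≤ L (C-bound L N i)) (C-bound L N (suc i)) ⟩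
  L * suc L ^ N + suc L ^ N                            ≡⟨ ℕP.+-comm (L * suc L ^ N) (suc L ^ N) ⟩
  suc L ^ suc N                                        ∎
  where
  open ℕP.≤-Reasoning
  split : ∀ a b L p → (a + b) * (L * p) ≡ L * (a * p) + b * (L * p)
  split = ℕSolver.solve-∀

C-ratio : ∀ N b → (N C suc (suc b)) * (suc (suc b) * suc b) ≡ (N C b) * ((N ∸ b) * (N ∸ suc b))
C-ratio N b = begin
  C₂ * (suc (suc b) * suc b)           ≡⟨ reorder₁ C₂ b ⟩
  suc b * (suc (suc b) * C₂)           ≡⟨ cong (suc b *_) (C-absorb N (suc b)) ⟩
  suc b * ((N ∸ suc b) * C₁)           ≡⟨ reorder₂ b (N ∸ suc b) C₁ ⟩
  (N ∸ suc b) * (suc b * C₁)           ≡⟨ cong ((N ∸ suc b) *_) (C-absorb N b) ⟩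
  (N ∸ suc b) * ((N ∸ b) * C₀)         ≡⟨ reorder₃ (N ∸ suc b) (N ∸ b) C₀ ⟩
  C₀ * ((N ∸ b) * (N ∸ suc b))         ∎
  where
  open ≡-Reasoning
  C₀ C₁ C₂ : ℕ
  C₀ = N C b
  C₁ = N C suc b
  C₂ = N C suc (suc b)
  reorder₁ : ∀ c b → c * (suc (suc b) * suc b) ≡ suc b * (suc (suc b) * c)
  reorder₁ = ℕSolver.solve-∀
  reorder₂ : ∀ b x c → suc b * (x * c) ≡ x * (suc b * c)
  reorder₂ = ℕSolver.solve-∀
  reorder₃ : ∀ x y c → x * (y * c) ≡ c * (y * x)
  reorder₃ = ℕSolver.solve-∀

module _ (N b L s : ℕ) where

  private
    C₀ C₂ P X : ℕ
    C₀ = N C b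
    C₂ = N C suc (suc b)
    P = suc (suc b) * suc b
    X = (N ∸ b) * (N ∸ suc b)

    P*C₂ : ∀ c → P * (c * c * C₂) ≡ c * c * (C₀ * X)
    P*C₂ c = trans (reorder P c C₂) (cong (c * c *_) (C-ratio N b))
      where
      reorder : ∀ p c x → p * (c * c * x) ≡ c * c * (x * p)
      reorder = ℕSolver.solve-∀

    P*C₀ : ∀ c → P * (c * c * C₀) ≡ C₀ * (c * c * P)
    P*C₀ c = reorder P c C₀
      where
      reorder : ∀ p c x → p * (c * c * x) ≡ x * (c * c * p)
      reorder = ℕSolver.solve-∀

    C₀*X : ∀ c → c * c * (C₀ * X) ≡ C₀ * (c * c * X)
    C₀*X c = reorder c C₀ X
      where
      reorder : ∀ c y x → c * c * (y * x) ≡ y * (c * c * x)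
      reorder = ℕSolver.solve-∀

  C-step-< : b ≤ N → s * s * P < L * L * X → s * s * C₀ < L * L * C₂
  C-step-< b≤N hyp = ℕP.*-cancelˡ-< P _ _ (begin-strict
    P * (s * s * C₀)    ≡⟨ P*C₀ s ⟩
    C₀ * (s * s * P)    <⟨ ℕP.*-monoʳ-< C₀ {{ℕ.>-nonZero (C-pos N b b≤N)}} hyp ⟩
    C₀ * (L * L * X)    ≡⟨ C₀*X L ⟨
    L * L * (C₀ * X)    ≡⟨ P*C₂ L ⟨
    P * (L * L * C₂)    ∎)
    where open ℕP.≤-Reasoning

  C-step-≤ : L * L * X ≤ s * s * P → L * L * C₂ ≤ s * s * C₀
  C-step-≤ hyp = ℕP.*-cancelˡ-≤ P (begin
    P * (L * L * C₂)    ≡⟨ P*C₂ L ⟩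
    L * L * (C₀ * X)    ≡⟨ C₀*X L ⟩
    C₀ * (L * L * X)    ≤⟨ ℕP.*-monoʳ-≤ C₀ hyp ⟩
    C₀ * (s * s * P)    ≡⟨ P*C₀ s ⟨
    P * (s * s * C₀)    ∎)
    where open ℕP.≤-Reasoning

module _ (A P Q μ : ℕ) where

  private
    E = + A ℤ.+ + μ ℤ.* (+ Q ℤ.- + P)

  sign-neg : A < μ → Q < P → E ℤ.< + 0
  sign-neg A<μ Q<P = begin-strict
    E                          ≡⟨ cong (λ p → + A ℤ.+ + μ ℤ.* (+ Q ℤ.- p)) (trans (cong +_ (sym P≡)) (ℤP.pos-+ (suc Q) D)) ⟩
    + A ℤ.+ + μ ℤ.* (+ Q ℤ.- (+ suc Q ℤ.+ + D))
                               ≡⟨ cong (λ q → + A ℤ.+ + μ ℤ.* (+ Q ℤ.- (q ℤ.+ + D))) (ℤP.pos-+ 1 Q) ⟩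
    + A ℤ.+ + μ ℤ.* (+ Q ℤ.- (+ 1 ℤ.+ + Q ℤ.+ + D))
                               ≡⟨ simplify (+ A) (+ μ) (+ Q) (+ D) ⟩
    + A ℤ.- + μ ℤ.* + suc D    ≡⟨ cong (λ x → + A ℤ.- x) (ℤP.pos-* μ (suc D)) ⟨
    + A ℤ.- + (μ * suc D)    ≡⟨ ℤP.[+m]-[+n]≡m⊖n A (μ * suc D) ⟩
    A ⊖ (μ * suc D)          <⟨ ℤP.⊖-monoʳ->-< A (ℕP.<-≤-trans A<μ (ℕP.m≤m*n μ (suc D))) ⟩
    A ⊖ A                      ≡⟨ ℤP.n⊖n≡0 A ⟩
    + 0                        ∎
    where
    open ℤP.≤-Reasoning
    D = P ∸ suc Q
    P≡ : suc Q + D ≡ P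
    P≡ = ℕP.m+[n∸m]≡n Q<P
    simplify : ∀ A μ Q D → A ℤ.+ μ ℤ.* (Q ℤ.- (+ 1 ℤ.+ Q ℤ.+ D)) ≡ A ℤ.- μ ℤ.* (+ 1 ℤ.+ D)
    simplify = ℤSolver.solve-∀

  sign-pos : 0 < A → P ≤ Q → + 0 ℤ.< E
  sign-pos 0<A P≤Q = begin-strict
    + 0                        <⟨ ℤ.+<+ (ℕP.<-≤-trans 0<A (ℕP.m≤m+n A (μ * D))) ⟩
    + (A + μ * D)          ≡⟨ trans (ℤP.pos-+ A (μ * D)) (cong (λ x → + A ℤ.+ x) (ℤP.pos-* μ D)) ⟩
    + A ℤ.+ + μ ℤ.* + D        ≡⟨ simplify (+ A) (+ μ) (+ P) (+ D) ⟨
    + A ℤ.+ + μ ℤ.* (+ P ℤ.+ + D ℤ.- + P)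
                               ≡⟨ cong (λ q → + A ℤ.+ + μ ℤ.* (q ℤ.- + P)) (trans (sym (ℤP.pos-+ P D)) (cong +_ Q≡)) ⟩
    E                          ∎
    where
    open ℤP.≤-Reasoning
    D = Q ∸ P
    Q≡ : P + D ≡ Q
    Q≡ = ℕP.m+[n∸m]≡n P≤Q
    simplify : ∀ A μ P D → A ℤ.+ μ ℤ.* (P ℤ.+ D ℤ.- P) ≡ A ℤ.+ μ ℤ.* D
    simplify = ℤSolver.solve-∀

-- k = k₄ + 4. Every b_i ≤ K, so μ′ = (1 + s)²·K bounds A_j; the Reeve height is m = suc m′ = 6μ.
module Construction (n k₄ : ℕ) where

  s L N K μ′ μ m′ : ℕ
  s  = suc k₄
  L  = suc n
  N  = n + s
  K  = suc L ^ N
  μ′ = suc s * suc s * K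
  μ  = suc μ′
  m′ = 5 + 6 * μ′

  vertices : Fin (4 * 2 ^ N) → Point (3 + N)
  vertices = prodVertices (reeve s (suc m′)) (box L N)

  q₁ q₂ q₃ : ℤ
  q₁ = (+ 2 ℤ.- + μ) ℤ.* + s
  q₂ = + s ℤ.* + s
  q₃ = + μ ℤ.* (+ s ℤ.* + s ℤ.* + s)

  B : ℕ → ℤ
  B j = + binomialCoeff L N j

  coeff : ℕ → ℤ
  coeff = mulCubic q₁ q₂ q₃ B

  hasDim : HasDim vertices (3 + N)
  hasDim = (prodChoice {d₁ = 3} id (boxChoice N) ,
            AffIndep-prod (reeve s (suc m′)) (box L N) id (boxChoice N) (AffIndep-reeve k₄ m′) (AffIndep-box n N)) ,
           (λ g → ¬AffIndep-d+2 (3 + N) (vertices ∘ g))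

  count≡ : ∀ t → + (reeveSize m′ (t * s) * suc (t * L) ^ N) ≡ evalℤ (3 + N) coeff (+ t)
  count≡ t = begin
    + (reeveSize m′ (t * s) * suc (t * L) ^ N)
      ≡⟨ *-cast (reeveSize m′ (t * s)) (suc (t * L) ^ N) (reeveSize-polynomial μ′ (t * s)) (^-cast (suc (t * L)) N) ⟩
    reeveCubic (+ (t * s)) ℤ.* (+ 1 ℤ.+ + (t * L)) ℤ.^ N
      ≡⟨ cong₂ (λ u v → reeveCubic u ℤ.* (+ 1 ℤ.+ v) ℤ.^ N) (ℤP.pos-* t s) (trans (ℤP.pos-* t L) (ℤP.*-comm (+ t) (+ L))) ⟩
    reeveCubic (+ t ℤ.* + s) ℤ.* (+ 1 ℤ.+ + L ℤ.* + t) ℤ.^ N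
      ≡⟨ cong₂ ℤ._*_ (expand (+ μ) (+ s) (+ t)) (sym (evalℤ-binomial L N (+ t))) ⟩
    (+ 1 ℤ.+ q₁ ℤ.* + t ℤ.+ q₂ ℤ.* (+ t ℤ.* + t) ℤ.+ q₃ ℤ.* (+ t ℤ.* + t ℤ.* + t)) ℤ.* evalℤ N B (+ t)
      ≡⟨ evalℤ-mulCubic q₁ q₂ q₃ N B (binomialCoeff-vanishes L N) (+ t) ⟨
    evalℤ (3 + N) coeff (+ t) ∎
    where
    open ≡-Reasoning
    reeveCubic : ℤ → ℤ
    reeveCubic u = + μ ℤ.* (u ℤ.* u ℤ.* u) ℤ.+ u ℤ.* u ℤ.+ (+ 2 ℤ.- + μ) ℤ.* u ℤ.+ + 1
    expand : ∀ μ s t → μ ℤ.* (t ℤ.* s ℤ.* (t ℤ.* s) ℤ.* (t ℤ.* s)) ℤ.+ t ℤ.* s ℤ.* (t ℤ.* s) ℤ.+ (+ 2 ℤ.- μ) ℤ.* (t ℤ.* s) ℤ.+ + 1 ≡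
                     + 1 ℤ.+ (+ 2 ℤ.- μ) ℤ.* s ℤ.* t ℤ.+ s ℤ.* s ℤ.* (t ℤ.* t) ℤ.+ μ ℤ.* (s ℤ.* s ℤ.* s) ℤ.* (t ℤ.* t ℤ.* t)
    expand = ℤSolver.solve-∀

  isEhrhart : IsEhrhartPoly vertices (3 + N) (ℤ→ℚ ∘ coeff)
  isEhrhart =
    (λ j 3+N<j → cong ℤ→ℚ (mulCubic-vanishes q₁ q₂ q₃ N B (binomialCoeff-vanishes L N) j 3+N<j)) ,
    λ { (suc t) _ →
      reeveSize m′ (suc t * s) * suc (suc t * L) ^ N ,
      LatticeCount-prod (reeve s (suc m′)) (box L N) (suc t) (LatticeCount-reeve s m′ (suc t)) (LatticeCount-box L N (suc t)) ,
      trans (cong ℤ→ℚ (count≡ (suc t))) (sym (evalPoly-ℤ→ℚ (3 + N) coeff (suc t))) }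

  private
    combination : ℕ → ℕ → ℕ → ℕ → ℤ
    combination x₀ x₁ x₂ x₃ = + x₀ ℤ.+ q₁ ℤ.* + x₁ ℤ.+ q₂ ℤ.* + x₂ ℤ.+ q₃ ℤ.* + x₃

    decompose : ∀ x₀ x₁ x₂ x₃ → combination x₀ x₁ x₂ x₃ ≡
                + (x₀ + 2 * s * x₁ + s * s * x₂) ℤ.+ + μ ℤ.* (+ (s * s * s * x₃) ℤ.- + (s * x₁))
    decompose x₀ x₁ x₂ x₃ = sym (begin
      + (x₀ + 2 * s * x₁ + s * s * x₂) ℤ.+ + μ ℤ.* (+ (s * s * s * x₃) ℤ.- + (s * x₁))
        ≡⟨ cong₂ (λ a b → + x₀ ℤ.+ a ℤ.+ b ℤ.+ + μ ℤ.* (+ (s * s * s * x₃) ℤ.- + (s * x₁)))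
                 (*-cast (2 * s) x₁ (ℤP.pos-* 2 s) refl) (*-cast (s * s) x₂ (ℤP.pos-* s s) refl) ⟩
      + x₀ ℤ.+ + 2 ℤ.* + s ℤ.* + x₁ ℤ.+ + s ℤ.* + s ℤ.* + x₂ ℤ.+ + μ ℤ.* (+ (s * s * s * x₃) ℤ.- + (s * x₁))
        ≡⟨ cong₂ (λ a b → + x₀ ℤ.+ + 2 ℤ.* + s ℤ.* + x₁ ℤ.+ + s ℤ.* + s ℤ.* + x₂ ℤ.+ + μ ℤ.* (a ℤ.- b))
                 (*-cast (s * s * s) x₃ (*-cast (s * s) s (ℤP.pos-* s s) refl) refl) (ℤP.pos-* s x₁) ⟩
      + x₀ ℤ.+ + 2 ℤ.* + s ℤ.* + x₁ ℤ.+ + s ℤ.* + s ℤ.* + x₂ ℤ.+ + μ ℤ.* (+ s ℤ.* + s ℤ.* + s ℤ.* + x₃ ℤ.- + s ℤ.* + x₁)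
        ≡⟨ regroup (+ x₀) (+ x₁) (+ x₂) (+ x₃) (+ s) (+ μ) ⟩
      combination x₀ x₁ x₂ x₃ ∎)
      where
      open ≡-Reasoning
      regroup : ∀ x₀ x₁ x₂ x₃ s μ →
        x₀ ℤ.+ + 2 ℤ.* s ℤ.* x₁ ℤ.+ s ℤ.* s ℤ.* x₂ ℤ.+ μ ℤ.* (s ℤ.* s ℤ.* s ℤ.* x₃ ℤ.- s ℤ.* x₁) ≡
        x₀ ℤ.+ (+ 2 ℤ.- μ) ℤ.* s ℤ.* x₁ ℤ.+ s ℤ.* s ℤ.* x₂ ℤ.+ μ ℤ.* (s ℤ.* s ℤ.* s) ℤ.* x₃
      regroup = ℤSolver.solve-∀

    combination-neg : ∀ x₀ x₁ x₂ x₃ → x₀ ≤ K → x₁ ≤ K → x₂ ≤ K → s * s * s * x₃ < s * x₁ → combination x₀ x₁ x₂ x₃ ℤ.< + 0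
    combination-neg x₀ x₁ x₂ x₃ x₀≤K x₁≤K x₂≤K Q<P = subst (ℤ._< + 0) (sym (decompose x₀ x₁ x₂ x₃))
      (sign-neg (x₀ + 2 * s * x₁ + s * s * x₂) (s * x₁) (s * s * s * x₃) μ (s≤s A≤μ′) Q<P)
      where
      A≤μ′ : x₀ + 2 * s * x₁ + s * s * x₂ ≤ μ′
      A≤μ′ = ℕP.≤-trans (ℕP.+-mono-≤ (ℕP.+-mono-≤ x₀≤K (ℕP.*-monoʳ-≤ (2 * s) x₁≤K)) (ℕP.*-monoʳ-≤ (s * s) x₂≤K))
                        (ℕP.≤-reflexive (square s K))
        where
        square : ∀ s K → K + 2 * s * K + s * s * K ≡ suc s * suc s * K
        square = ℕSolver.solve-∀

    combination-pos : ∀ x₀ x₁ x₂ x₃ → 0 < x₁ → s * x₁ ≤ s * s * s * x₃ → + 0 ℤ.< combination x₀ x₁ x₂ x₃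
    combination-pos x₀ x₁ x₂ x₃ 0<x₁ P≤Q = subst (+ 0 ℤ.<_) (sym (decompose x₀ x₁ x₂ x₃))
      (sign-pos (x₀ + 2 * s * x₁ + s * s * x₂) (s * x₁) (s * s * s * x₃) μ 0<A P≤Q)
      where
      0<A : 0 < x₀ + 2 * s * x₁ + s * s * x₂
      0<A = ℕP.<-≤-trans (ℕ.>-nonZero⁻¹ (2 * s * x₁) {{ℕP.m*n≢0 (2 * s) x₁ {{_}} {{ℕ.>-nonZero 0<x₁}}}})
                         (ℕP.≤-trans (ℕP.m≤n+m (2 * s * x₁) x₀) (ℕP.m≤m+n (x₀ + 2 * s * x₁) (s * s * x₂)))

  private
    N∸n≡s : N ∸ n ≡ s
    N∸n≡s = ℕP.m+n∸m≡n n s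

    ratio-below : ∀ b → suc b ≤ n → s * s * (suc (suc b) * suc b) < L * L * ((N ∸ b) * (N ∸ suc b))
    ratio-below b 1+b≤n = begin-strict
      s * s * (suc (suc b) * suc b)    <⟨ ℕP.*-monoʳ-< (s * s) (ℕP.≤-<-trans (ℕP.*-monoˡ-≤ (suc b) 2+b≤L) (ℕP.*-monoʳ-< L 2+b≤L)) ⟩
      s * s * (L * L)                  ≤⟨ ℕP.*-monoˡ-≤ (L * L) (ℕP.*-mono-≤ s≤N∸b s≤N∸1+b) ⟩
      (N ∸ b) * (N ∸ suc b) * (L * L)  ≡⟨ ℕP.*-comm ((N ∸ b) * (N ∸ suc b)) (L * L) ⟩
      L * L * ((N ∸ b) * (N ∸ suc b))  ∎
      where
      open ℕP.≤-Reasoning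
      2+b≤L : suc (suc b) ≤ L
      2+b≤L = s≤s 1+b≤n
      s≤N∸1+b : s ≤ N ∸ suc b
      s≤N∸1+b = subst (_≤ N ∸ suc b) N∸n≡s (ℕP.∸-monoʳ-≤ N 1+b≤n)
      s≤N∸b : s ≤ N ∸ b
      s≤N∸b = ℕP.≤-trans s≤N∸1+b (ℕP.∸-monoʳ-≤ N (ℕP.n≤1+n b))

    ratio-above : ∀ b → n ≤ b → L * L * ((N ∸ b) * (N ∸ suc b)) ≤ s * s * (suc (suc b) * suc b)
    ratio-above b n≤b = begin
      L * L * ((N ∸ b) * (N ∸ suc b))  ≤⟨ ℕP.*-mono-≤ (ℕP.*-mono-≤ (ℕP.m≤n⇒m≤1+n L≤1+b) L≤1+b) (ℕP.*-mono-≤ N∸b≤s N∸1+b≤s) ⟩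
      suc (suc b) * suc b * (s * s)    ≡⟨ ℕP.*-comm (suc (suc b) * suc b) (s * s) ⟩
      s * s * (suc (suc b) * suc b)    ∎
      where
      open ℕP.≤-Reasoning
      L≤1+b : L ≤ suc b
      L≤1+b = s≤s n≤b
      N∸b≤s : N ∸ b ≤ s
      N∸b≤s = subst (N ∸ b ≤_) N∸n≡s (ℕP.∸-monoʳ-≤ N n≤b)
      N∸1+b≤s : N ∸ suc b ≤ s
      N∸1+b≤s = ℕP.≤-trans (ℕP.∸-monoʳ-≤ N (ℕP.n≤1+n b)) N∸b≤s

    scale : ∀ b c → s * s * s * (c * L ^ b) ≡ s * L ^ b * (s * s * c)
    scale b c = reorder s c (L ^ b)
      where
      reorder : ∀ s c p → s * s * s * (c * p) ≡ s * p * (s * s * c)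
      reorder = ℕSolver.solve-∀

    scale₂ : ∀ b c → s * L ^ b * (L * L * c) ≡ s * (c * L ^ suc (suc b))
    scale₂ b c = reorder s c L (L ^ b)
      where
      reorder : ∀ s c L p → s * p * (L * L * c) ≡ s * (c * (L * (L * p)))
      reorder = ℕSolver.solve-∀

    sL^b≢0 : ∀ b → ℕ.NonZero (s * L ^ b)
    sL^b≢0 b = ℕP.m*n≢0 s (L ^ b) {{_}} {{ℕP.m^n≢0 L b}}

    binomial-neg : ∀ b → suc b ≤ n → s * s * s * binomialCoeff L N b < s * binomialCoeff L N (suc (suc b))
    binomial-neg b 1+b≤n = begin-strict
      s * s * s * binomialCoeff L N b                ≡⟨ scale b (N C b) ⟩
      s * L ^ b * (s * s * (N C b))
        <⟨ ℕP.*-monoʳ-< (s * L ^ b) {{sL^b≢0 b}} (C-step-< N b L s b≤N (ratio-below b 1+b≤n)) ⟩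
      s * L ^ b * (L * L * (N C suc (suc b)))        ≡⟨ scale₂ b (N C suc (suc b)) ⟩
      s * binomialCoeff L N (suc (suc b))            ∎
      where
      open ℕP.≤-Reasoning
      b≤N : b ≤ N
      b≤N = ℕP.≤-trans (ℕP.n≤1+n b) (ℕP.≤-trans 1+b≤n (ℕP.m≤m+n n s))

    binomial-pos : ∀ b → n ≤ b → s * binomialCoeff L N (suc (suc b)) ≤ s * s * s * binomialCoeff L N b
    binomial-pos b n≤b = begin
      s * binomialCoeff L N (suc (suc b))            ≡⟨ scale₂ b (N C suc (suc b)) ⟨
      s * L ^ b * (L * L * (N C suc (suc b)))        ≤⟨ ℕP.*-monoʳ-≤ (s * L ^ b) (C-step-≤ N b L s (ratio-above b n≤b)) ⟩
      s * L ^ b * (s * s * (N C b))                  ≡⟨ scale b (N C b) ⟨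
      s * s * s * binomialCoeff L N b                ∎
      where open ℕP.≤-Reasoning

    binomialCoeff-pos : ∀ i → i ≤ N → 0 < binomialCoeff L N i
    binomialCoeff-pos i i≤N = ℕP.*-mono-≤ (C-pos N i i≤N) (ℕP.m^n>0 L i)

  coeff-neg : ∀ j → 1 ≤ j → j ≤ n + 2 → coeff j ℤ.< + 0
  coeff-neg (suc zero) _ _ =
    combination-neg _ _ 0 0 (C-bound L N 1) (C-bound L N 0) z≤n (subst (_< s * 1) (sym (ℕP.*-zeroʳ (s * s * s))) (s≤s z≤n))
  coeff-neg (suc (suc zero)) _ _ =
    combination-neg _ _ _ 0 (C-bound L N 2) (C-bound L N 1) (C-bound L N 0)
      (subst (_< s * binomialCoeff L N 1) (sym (ℕP.*-zeroʳ (s * s * s)))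
             (ℕP.*-mono-≤ {1} {s} (s≤s z≤n) (binomialCoeff-pos 1 (ℕP.≤-trans (s≤s z≤n) (ℕP.m≤n+m s n)))))
  coeff-neg (suc (suc (suc b))) _ 3+b≤n+2 =
    combination-neg _ _ _ _ (C-bound L N (3 + b)) (C-bound L N (2 + b)) (C-bound L N (1 + b))
      (binomial-neg b (ℕP.+-cancelʳ-≤ 2 (suc b) n (subst (_≤ n + 2) (ℕP.+-comm 2 (suc b)) 3+b≤n+2)))

  coeff-pos : ∀ j → n + 3 ≤ j → j ≤ N + 1 → + 0 ℤ.< coeff j
  coeff-pos j n+3≤j j≤N+1 with ℕP.m+n≤o⇒n≤o n n+3≤j
  coeff-pos (suc (suc (suc b))) n+3≤j j≤N+1 | s≤s (s≤s (s≤s _)) =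
    combination-pos _ _ _ _ (binomialCoeff-pos (2 + b) 2+b≤N) (binomial-pos b n≤b)
    where
    n≤b : n ≤ b
    n≤b = ℕP.+-cancelʳ-≤ 3 n b (subst (n + 3 ≤_) (ℕP.+-comm 3 b) n+3≤j)
    2+b≤N : 2 + b ≤ N
    2+b≤N = ℕP.+-cancelʳ-≤ 1 (2 + b) N (subst (_≤ N + 1) (ℕP.+-comm 1 (2 + b)) j≤N+1)

theorem4p4 : (n k : ℕ) → 1 ≤ n → 4 ≤ k →
    Σ ℕ λ N → Σ ℕ λ m → Σ (Fin m → Point N) λ V →
      HasDim V (n + k) ×
      Σ (ℕ → ℚ) λ a →
        IsEhrhartPoly V (n + k) a ×
        (∀ j → n + 3 ≤ j → j ≤ n + k ∸ 2 → 0ℚ <ℚ a j) ×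
        (∀ j → 1 ≤ j → j ≤ n + 2 → a j <ℚ 0ℚ)
-- The construction works for n = 0 as well.
theorem4p4 n _ _ (s≤s (s≤s (s≤s (s≤s {n = k₄} _)))) =
  3 + N , 4 * 2 ^ N , vertices ,
  subst (HasDim vertices) dim≡ hasDim ,
  ℤ→ℚ ∘ coeff ,
  subst (λ d → IsEhrhartPoly vertices d (ℤ→ℚ ∘ coeff)) dim≡ isEhrhart ,
  (λ j n+3≤j j≤ → ℤ→ℚ-mono-< (coeff-pos j n+3≤j (subst (j ≤_) top≡ j≤))) ,
  (λ j 1≤j j≤n+2 → ℤ→ℚ-mono-< (coeff-neg j 1≤j j≤n+2))
  where
  open Construction n k₄
  dim≡ : 3 + N ≡ n + (4 + k₄)
  dim≡ = rearrange n k₄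
    where
    rearrange : ∀ n k → 3 + (n + suc k) ≡ n + (4 + k)
    rearrange = ℕSolver.solve-∀
  top≡ : n + (4 + k₄) ∸ 2 ≡ N + 1
  top≡ = trans (cong (_∸ 2) (rearrange n k₄)) (ℕP.m+n∸n≡m (N + 1) 2)
    where
    rearrange : ∀ n k → n + (4 + k) ≡ n + suc k + 1 + 2
    rearrange = ℕSolver.solve-∀
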